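{- For integers $p',q',r'$ let $\min(p',q',r';|E|)$ denote the minimum of $|E(G)|$ over all connected finite simple graphs $G$ with $\mathrm{ind\text{ - }match}(G)=p'$, $\mathrm{min\text{ - }match}(G)=q'$ and $\mathrm{match}(G)=r'$. Let $p,q,r$ be integers with $1\le p\le q\le r\le 2q$. Then: (1) $\min(1,q,2q;|E|)=\binom{2q+1}{2}$ and $\min(1,q,2q-1;|E|)=\binom{2q}{2}$ for all $q\ge 1$; (2) $\min(q,q,r;|E|)=2r-1$ if $2\le p=q<r\le 2q$; (3) $\min(r,r,r;|E|)=2r$ if $2\le p=q=r$.
   Context: All graphs are finite and simple. A matching of $G$ is a set of pairwise disjoint edges. A maximal matching is a matching not properly contained in another matching. An induced matching is a matching $M$ such that for distinct $e,f\in M$ there is no edge $g$ of $G$ meeting both $e$ and $f$. $\mathrm{match}(G)$ is the maximum size of a matching, $\mathrm{min\text{ - }match}(G)$ the minimum size of a maximal matching, and $\mathrm{ind\text{ - }match}(G)$ the maximum size of an induced matching of $G$. For every $1\le p\le q\le r\le 2q$ there exists a connected graph with these three invariants equal to $p,q,r$. -}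

module Defs where

open import Data.Nat using (ℕ; zero; suc; _+_; _≤_)
open import Data.Bool using (Bool; true; false; if_then_else_)
open import Data.Fin using (Fin; toℕ)
open import Data.Fin.Properties using (_<?_)
open import Data.List using (List; []; _∷_; concatMap; filter; map; allFin)
open import Data.Nat.ListAction using (sum)
open import Data.Product using (_×_; _,_; ∃; ∃-syntax; Σ)
open import Data.Sum using (_⊎_)
open import Relation.Nullary using (¬_)
open import Relation.Binary.PropositionalEquality using (_≡_)
open import Relation.Binary.Construct.Closure.ReflexiveTransitive using (Star)

record Graph : Set where
  field
    n      : ℕ
    adj    : Fin n → Fin n → Bool
    sym    : ∀ i j → adj i j ≡ adj j i
    irrefl : ∀ i → adj i i ≡ false
open Graph public

pairs : (n : ℕ) → List (Fin n × Fin n)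
pairs n = filter (λ { (i , j) → i <? j })
                 (concatMap (λ i → map (λ j → (i , j)) (allFin n)) (allFin n))

size : {n : ℕ} → (Fin n → Fin n → Bool) → ℕ
size {n} S = sum (map (λ { (i , j) → if S i j then 1 else 0 }) (pairs n))

numEdges : Graph → ℕ
numEdges G = size (adj G)

Connected : Graph → Set
Connected G = ∀ (u v : Fin (n G)) → Star (λ i j → adj G i j ≡ true) u v

IsEdgeSet : (G : Graph) → (Fin (n G) → Fin (n G) → Bool) → Set
IsEdgeSet G M = (∀ i j → M i j ≡ M j i) × (∀ i j → M i j ≡ true → adj G i j ≡ true)

IsMatching : (G : Graph) → (Fin (n G) → Fin (n G) → Bool) → Set
IsMatching G M = IsEdgeSet G M ×
  (∀ u v w → M u v ≡ true → M u w ≡ true → v ≡ w)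

ProperSub : {k : ℕ} → (Fin k → Fin k → Bool) → (Fin k → Fin k → Bool) → Set
ProperSub M M' = (∀ i j → M i j ≡ true → M' i j ≡ true) ×
                 (∃[ i ] ∃[ j ] (M' i j ≡ true × ¬ (M i j ≡ true)))

IsMaximalMatching : (G : Graph) → (Fin (n G) → Fin (n G) → Bool) → Set
IsMaximalMatching G M = IsMatching G M ×
  (∀ M' → IsMatching G M' → ¬ ProperSub M M')

_∈E_ : {k : ℕ} → Fin k → Fin k × Fin k → Set
x ∈E (a , b) = x ≡ a ⊎ x ≡ b

IsInducedMatching : (G : Graph) → (Fin (n G) → Fin (n G) → Bool) → Set
IsInducedMatching G M = IsMatching G M ×
  (∀ a b c d → M a b ≡ true → M c d ≡ true →
     ¬ ((a ≡ c × b ≡ d) ⊎ (a ≡ d × b ≡ c)) →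
     ¬ (∃[ x ] ∃[ y ] (adj G x y ≡ true
          × (x ∈E (a , b) ⊎ y ∈E (a , b))
          × (x ∈E (c , d) ⊎ y ∈E (c , d)))))

MatchNum : Graph → ℕ → Set
MatchNum G r = (∃[ M ] (IsMatching G M × size M ≡ r)) ×
               (∀ M → IsMatching G M → size M ≤ r)

MinMatchNum : Graph → ℕ → Set
MinMatchNum G q = (∃[ M ] (IsMaximalMatching G M × size M ≡ q)) ×
                  (∀ M → IsMaximalMatching G M → q ≤ size M)

IndMatchNum : Graph → ℕ → Set
IndMatchNum G p = (∃[ M ] (IsInducedMatching G M × size M ≡ p)) ×
                  (∀ M → IsInducedMatching G M → size M ≤ p)

Realizes : Graph → ℕ → ℕ → ℕ → Set
Realizes G p q r = Connected G × IndMatchNum G p × MinMatchNum G q × MatchNum G r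

MinEdges : ℕ → ℕ → ℕ → ℕ → Set
MinEdges p q r m = (∃[ G ] (Realizes G p q r × numEdges G ≡ m)) ×
                   (∀ G → Realizes G p q r → m ≤ numEdges G)

{-# OPTIONS --safe #-}

-- A matching of size r needs 2r vertices, and a connected graph on n vertices
-- contains a breadth-first spanning tree, hence has at least n − 1 edges; this gives 2r − 1.
-- If moreover ind-match = match = r ≥ 2 and there were exactly 2r vertices, a maximum induced
-- matching would be perfect, so no edge could leave any of its edges and the graph would be
-- disconnected; hence there are at least 2r + 1 vertices and 2r edges.  If ind-match = 1, any two
-- edges of a maximum matching M are joined by an edge (otherwise they form an induced matching of
-- size 2), so the two ends of each edge of M have degree sum at least |M| + 1; summing over M
-- gives |E| ≥ |M|(|M| + 1)/2.
--
-- K_r with a pendant leaf at every vertex realises (1, ⌈r/2⌉, r) with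
-- (r + 1 choose 2) edges, since every maximal matching must cover all clique vertices.  For the
-- other two cases trees on 2r and 2r + 1 vertices suffice; there ind-match and min-match are both
-- pinned to q by exhibiting an induced and a maximal matching of size q, because an induced
-- matching is never larger than a maximal one.
module Submission where

open import Defs hiding (sym)

open import Level using (0ℓ)
open import Function using (_∘_; id)
open import Function.Bundles using (mk⇔)
open import Data.Empty using (⊥; ⊥-elim)
open import Data.Product using (_×_; _,_; ∃-syntax; proj₁; proj₂)
open import Data.Sum using (_⊎_; inj₁; inj₂; [_,_]′; swap)
import Data.Sum as Sum
open import Data.Sum.Properties using (swap-involutive)
open import Data.Bool using (Bool; true; false; if_then_else_; not; _∧_; _∨_)
import Data.Bool as Bool
open import Data.Bool.Properties using (⇔→≡; ∨-zeroʳ; ∨-comm; not-¬)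
open import Data.Nat using (ℕ; zero; suc; _+_; _*_; _∸_; _≤_; _<_; z≤n; s≤s; _<?_)
open import Data.Nat.Properties
open import Data.Nat.Combinatorics using (_C_; nCk+nC[k+1]≡[n+1]C[k+1]; nC1≡n)
open import Data.Nat.Tactic.RingSolver using (solve-∀)
import Data.Nat.ListAction as List
open import Data.Nat.ListAction.Properties using (sum-++)
open import Data.Fin using (Fin; _↑ˡ_; _↑ʳ_; splitAt; join; fromℕ<) renaming (zero to fz; suc to fs)
import Data.Fin.Properties as Fin
open import Data.List using (List; []; _∷_; _++_; map; filter; concatMap; allFin; tabulate)
open import Data.List.Properties using (map-++; map-∘; map-tabulate)
open import Relation.Nullary using (¬_; Dec; yes; no; does)
open import Relation.Nullary.Decidable using (dec-true; dec-false)
open import Relation.Unary using (Pred; Decidable)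
open import Relation.Binary using (tri<; tri≈; tri>)
open import Relation.Binary.PropositionalEquality
  using (_≡_; _≢_; refl; sym; trans; cong; cong₂; subst; subst₂; module ≡-Reasoning)
open import Relation.Binary.Construct.Closure.ReflexiveTransitive using (Star; ε; _◅_; _◅◅_; reverse)
open import Algebra.Properties.Semiring.Sum +-*-semiring
  using (sum-syntax; ∑-comm; ∑-distrib-+; *-distribˡ-sum; sum-cong-≗) renaming (sum to ∑)


-- Counting over Fin n

⟦_⟧ : Bool → ℕ
⟦ b ⟧ = if b then 1 else 0

⟦⟧≤1 : ∀ b → ⟦ b ⟧ ≤ 1
⟦⟧≤1 true  = ≤-refl
⟦⟧≤1 false = z≤n

⟦⟧*≤ : ∀ b x → ⟦ b ⟧ * x ≤ x
⟦⟧*≤ true  x = ≤-reflexive (+-identityʳ x)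
⟦⟧*≤ false x = z≤n

∧-true : ∀ a {b} → a ∧ b ≡ true → a ≡ true × b ≡ true
∧-true true e = refl , e

∨-true : ∀ a {b} → a ∨ b ≡ true → a ≡ true ⊎ b ≡ true
∨-true true  _ = inj₁ refl
∨-true false e = inj₂ e

⟦⟧-* : ∀ a b → ⟦ a ⟧ * ⟦ b ⟧ ≡ ⟦ a ∧ b ⟧
⟦⟧-* true  b = +-identityʳ ⟦ b ⟧
⟦⟧-* false b = refl

_==_ : ∀ {n} → Fin n → Fin n → Bool
i == j = does (i Fin.≟ j)

==-refl : ∀ {n} (i : Fin n) → (i == i) ≡ true
==-refl i = dec-true (i Fin.≟ i) refl

==-≢ : ∀ {n} {i j : Fin n} → i ≢ j → (i == j) ≡ false
==-≢ {i = i} {j} = dec-false (i Fin.≟ j)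

==⇒≡ : ∀ {n} {i j : Fin n} → (i == j) ≡ true → i ≡ j
==⇒≡ {i = i} {j} e with i Fin.≟ j
... | yes i≡j = i≡j

==-sym : ∀ {n} (i j : Fin n) → (i == j) ≡ (j == i)
==-sym i j with i Fin.≟ j
... | yes refl = sym (==-refl i)
... | no i≢j   = sym (==-≢ (i≢j ∘ sym))

∑-mono-≤ : ∀ {n} {f g : Fin n → ℕ} → (∀ i → f i ≤ g i) → ∑ f ≤ ∑ g
∑-mono-≤ {zero}  f≤g = z≤n
∑-mono-≤ {suc n} f≤g = +-mono-≤ (f≤g fz) (∑-mono-≤ (f≤g ∘ fs))

∑-const : ∀ n c → ∑[ i < n ] c ≡ n * c
∑-const zero    c = refl
∑-const (suc n) c = cong (c +_) (∑-const n c)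

∑-1 : ∀ n → ∑[ i < n ] 1 ≡ n
∑-1 n = trans (∑-const n 1) (*-identityʳ n)

∑0 : ∀ n → ∑[ i < n ] 0 ≡ 0
∑0 n = trans (∑-const n 0) (*-zeroʳ n)

∑-zero : ∀ {n} {f : Fin n → ℕ} → (∀ i → f i ≡ 0) → ∑ f ≡ 0
∑-zero {n} f≡0 = trans (sum-cong-≗ f≡0) (∑0 n)

∑-*ˡ : ∀ {n} c (f : Fin n → ℕ) → ∑[ i < n ] (c * f i) ≡ c * ∑ f
∑-*ˡ c f = sym (*-distribˡ-sum c f)

∑-↑ : ∀ m n (f : Fin (m + n) → ℕ) → ∑ f ≡ ∑[ i < m ] f (i ↑ˡ n) + ∑[ j < n ] f (m ↑ʳ j)
∑-↑ zero    n f = refl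
∑-↑ (suc m) n f = trans (cong (f fz +_) (∑-↑ m n (f ∘ fs))) (sym (+-assoc (f fz) _ _))

∑-splitAt : ∀ m n (F : Fin m ⊎ Fin n → ℕ) →
  ∑[ u < m + n ] F (splitAt m u) ≡ ∑ (F ∘ inj₁) + ∑ (F ∘ inj₂)
∑-splitAt m n F = trans (∑-↑ m n _)
  (cong₂ _+_ (sum-cong-≗ (λ i → cong F (Fin.splitAt-↑ˡ m i n)))
             (sum-cong-≗ (λ j → cong F (Fin.splitAt-↑ʳ m n j))))

∑-point : ∀ {n} (c : Fin n) (h : Fin n → ℕ) → ∑[ w < n ] (⟦ c == w ⟧ * h w) ≡ h c
∑-point {suc n} fz h = trans (cong₂ _+_ (+-identityʳ (h fz)) (∑0 n)) (+-identityʳ (h fz))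
∑-point {suc n} (fs c) h = trans (sum-cong-≗ (λ i → cong (λ b → ⟦ b ⟧ * h (fs i)) (==-fs i)))
                                 (∑-point c (h ∘ fs))
  where
  ==-fs : ∀ i → (fs c == fs i) ≡ (c == i)
  ==-fs i with c Fin.≟ i
  ... | yes _ = refl
  ... | no _  = refl

count : ∀ {n} → (Fin n → Bool) → ℕ
count P = ∑ (λ i → ⟦ P i ⟧)

count-singleton : ∀ {n} (c : Fin n) → count (c ==_) ≡ 1
count-singleton {n} c = trans (sum-cong-≗ {n} (λ w → sym (*-identityʳ _))) (∑-point c (λ _ → 1))

count≤n : ∀ {n} (P : Fin n → Bool) → count P ≤ n
count≤n {n} P = ≤-trans (∑-mono-≤ (⟦⟧≤1 ∘ P)) (≤-reflexive (∑-1 n))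

count-mono : ∀ {n} {P Q : Fin n → Bool} → (∀ i → P i ≡ true → Q i ≡ true) → count P ≤ count Q
count-mono {P = P} {Q} P⊆Q = ∑-mono-≤ pointwise
  where
  pointwise : ∀ i → ⟦ P i ⟧ ≤ ⟦ Q i ⟧
  pointwise i with P i in e
  ... | true  rewrite P⊆Q i e = ≤-refl
  ... | false = z≤n

count-subsingleton : ∀ {n} (P : Fin n → Bool) →
  (∀ v w → P v ≡ true → P w ≡ true → v ≡ w) → count P ≤ 1
count-subsingleton {zero}  P unique = z≤n
count-subsingleton {suc n} P unique with P fz in e
... | true  = ≤-reflexive (cong suc (∑-zero {n} rest-empty))
  where
  rest-empty : ∀ i → ⟦ P (fs i) ⟧ ≡ 0
  rest-empty i with P (fs i) in e′
  ... | true with () ← unique _ _ e e′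
  ... | false = refl
... | false = count-subsingleton (P ∘ fs) (λ v w p q → Fin.suc-injective (unique _ _ p q))

count-complement : ∀ {n} (P : Fin n → Bool) → count P + count (not ∘ P) ≡ n
count-complement {n} P = trans (sym (∑-distrib-+ {n} _ _)) (trans (sum-cong-≗ {n} (one ∘ P)) (∑-1 n))
  where
  one : ∀ b → ⟦ b ⟧ + ⟦ not b ⟧ ≡ 1
  one true  = refl
  one false = refl

count-≢ : ∀ {n} (v : Fin n) → count (λ u → not (u == v)) ≡ n ∸ 1
count-≢ {n} v = begin
  count (λ u → not (u == v))                     ≡⟨ sym (m+n∸m≡n 1 _) ⟩
  1 + count (λ u → not (u == v)) ∸ 1             ≡⟨ cong (λ c → c + count (λ u → not (u == v)) ∸ 1) count-v ⟩
  count (_== v) + count (λ u → not (u == v)) ∸ 1 ≡⟨ cong (_∸ 1) (count-complement (_== v)) ⟩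
  n ∸ 1                                          ∎
  where
  open ≡-Reasoning
  count-v : 1 ≡ count (_== v)
  count-v = trans (sym (count-singleton v)) (sum-cong-≗ {n} (cong ⟦_⟧ ∘ ==-sym v))

count-∨-disjoint : ∀ {n} (P Q : Fin n → Bool) → (∀ x → P x ≡ true → Q x ≡ false) →
  count (λ x → P x ∨ Q x) ≡ count P + count Q
count-∨-disjoint {n} P Q disjoint = trans (sum-cong-≗ {n} split) (∑-distrib-+ {n} _ _)
  where
  split : ∀ x → ⟦ P x ∨ Q x ⟧ ≡ ⟦ P x ⟧ + ⟦ Q x ⟧
  split x with P x in Px
  ... | true rewrite disjoint x Px = refl
  ... | false = refl

count≡n⇒all : ∀ {n} (P : Fin n → Bool) → count P ≡ n → ∀ v → P v ≡ true
count≡n⇒all {suc n} P count≡n v with P v in Pv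
... | true  = refl
... | false = ⊥-elim (1+n≰n (begin
  suc n                        ≡⟨ sym count≡n ⟩
  count P                      ≤⟨ count-mono P⊆≢v ⟩
  count (λ u → not (u == v))   ≡⟨ count-≢ v ⟩
  n                            ∎))
  where
  open ≤-Reasoning
  P⊆≢v : ∀ u → P u ≡ true → not (u == v) ≡ true
  P⊆≢v u Pu with u Fin.≟ v
  ... | yes refl with () ← trans (sym Pu) Pv
  ... | no _ = refl

∑-fibre≤ : ∀ {n} {A B : Fin n → Bool} (f : Fin n → Fin n) (h : Fin n → ℕ) →
  (∀ v → A v ≡ true → B (f v) ≡ true) →
  (∀ v w → A v ≡ true → A w ≡ true → f v ≡ f w → v ≡ w) →
  ∀ w → ∑[ v < n ] (⟦ A v ⟧ * (⟦ f v == w ⟧ * h w)) ≤ ⟦ B w ⟧ * h w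
∑-fibre≤ {n} {A} {B} f h A⇒Bf f-inj w with B w in Bw
... | true  = begin
  ∑[ v < n ] (⟦ A v ⟧ * (⟦ f v == w ⟧ * h w)) ≡⟨ sum-cong-≗ {n} regroup ⟩
  ∑[ v < n ] (h w * ⟦ fibre v ⟧)              ≡⟨ ∑-*ˡ {n} (h w) _ ⟩
  h w * count fibre                           ≤⟨ *-monoʳ-≤ (h w) (count-subsingleton fibre fibre-unique) ⟩
  h w * 1                                     ≡⟨ *-comm (h w) 1 ⟩
  1 * h w                                     ∎
  where
  open ≤-Reasoning
  fibre : Fin n → Bool
  fibre v = A v ∧ (f v == w)
  regroup : ∀ v → ⟦ A v ⟧ * (⟦ f v == w ⟧ * h w) ≡ h w * ⟦ fibre v ⟧
  regroup v = trans (sym (*-assoc ⟦ A v ⟧ _ _)) (trans (cong (_* h w) (⟦⟧-* (A v) (f v == w))) (*-comm _ (h w)))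
  fibre-unique : ∀ u v → fibre u ≡ true → fibre v ≡ true → u ≡ v
  fibre-unique u v p q with ∧-true (A u) p | ∧-true (A v) q
  ... | Au , fu | Av , fv = f-inj u v Au Av (trans (==⇒≡ fu) (sym (==⇒≡ fv)))
... | false = ≤-reflexive (∑-zero {n} vanish)
  where
  vanish : ∀ v → ⟦ A v ⟧ * (⟦ f v == w ⟧ * h w) ≡ 0
  vanish v with A v in Av | f v Fin.≟ w
  ... | true  | yes refl with () ← trans (sym (A⇒Bf v Av)) Bw
  ... | true  | no _ = *-zeroˡ (h w)
  ... | false | _    = refl

∑-inject-≤ : ∀ {n} {A B : Fin n → Bool} (f : Fin n → Fin n) (h : Fin n → ℕ) →
  (∀ v → A v ≡ true → B (f v) ≡ true) →
  (∀ v w → A v ≡ true → A w ≡ true → f v ≡ f w → v ≡ w) →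
  ∑[ v < n ] (⟦ A v ⟧ * h (f v)) ≤ ∑[ w < n ] (⟦ B w ⟧ * h w)
∑-inject-≤ {n} {A} {B} f h A⇒Bf f-inj = begin
  ∑[ v < n ] (⟦ A v ⟧ * h (f v))
    ≡⟨ sum-cong-≗ {n} (λ v → cong (⟦ A v ⟧ *_) (sym (∑-point (f v) h))) ⟩
  ∑[ v < n ] (⟦ A v ⟧ * ∑[ w < n ] (⟦ f v == w ⟧ * h w))
    ≡⟨ sum-cong-≗ {n} (λ v → sym (∑-*ˡ {n} ⟦ A v ⟧ _)) ⟩
  ∑[ v < n ] ∑[ w < n ] (⟦ A v ⟧ * (⟦ f v == w ⟧ * h w))
    ≡⟨ ∑-comm {n} {n} _ ⟩
  ∑[ w < n ] ∑[ v < n ] (⟦ A v ⟧ * (⟦ f v == w ⟧ * h w))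
    ≤⟨ ∑-mono-≤ (∑-fibre≤ {A = A} {B} f h A⇒Bf f-inj) ⟩
  ∑[ w < n ] (⟦ B w ⟧ * h w) ∎
  where open ≤-Reasoning

count-inject-≤ : ∀ {n} {A B : Fin n → Bool} (f : Fin n → Fin n) →
  (∀ v → A v ≡ true → B (f v) ≡ true) →
  (∀ v w → A v ≡ true → A w ≡ true → f v ≡ f w → v ≡ w) →
  count A ≤ count B
count-inject-≤ {n} {A} {B} f A⇒Bf f-inj =
  subst₂ _≤_ (sum-cong-≗ {n} (λ v → *-identityʳ ⟦ A v ⟧)) (sum-cong-≗ {n} (λ v → *-identityʳ ⟦ B v ⟧))
         (∑-inject-≤ {A = A} {B} f (λ _ → 1) A⇒Bf f-inj)

∑-involution : ∀ {n} {A : Fin n → Bool} (f : Fin n → Fin n) (h : Fin n → ℕ) →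
  (∀ v → A v ≡ true → A (f v) ≡ true) → (∀ v → A v ≡ true → f (f v) ≡ v) →
  ∑[ v < n ] (⟦ A v ⟧ * h (f v)) ≡ ∑[ v < n ] (⟦ A v ⟧ * h v)
∑-involution {n} {A} f h closed involutive = ≤-antisym (∑-inject-≤ {A = A} {A} f h closed f-inj) (begin
  ∑[ v < n ] (⟦ A v ⟧ * h v)         ≡⟨ sum-cong-≗ {n} h≡h∘f∘f ⟩
  ∑[ v < n ] (⟦ A v ⟧ * h (f (f v))) ≤⟨ ∑-inject-≤ {A = A} {A} f (h ∘ f) closed f-inj ⟩
  ∑[ v < n ] (⟦ A v ⟧ * h (f v))     ∎)
  where
  open ≤-Reasoning
  f-inj : ∀ v w → A v ≡ true → A w ≡ true → f v ≡ f w → v ≡ w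
  f-inj v w Av Aw fv≡fw = trans (sym (involutive v Av)) (trans (cong f fv≡fw) (involutive w Aw))
  h≡h∘f∘f : ∀ v → ⟦ A v ⟧ * h v ≡ ⟦ A v ⟧ * h (f (f v))
  h≡h∘f∘f v with A v in Av
  ... | true  = cong (λ u → 1 * h u) (sym (involutive v Av))
  ... | false = refl


-- Edge counts and degrees

∑∑-symmetrise : ∀ {n} (F : Fin n → Fin n → ℕ) →
  ∑[ i < n ] ∑[ j < n ] (F i j + F j i) ≡ 2 * ∑[ i < n ] ∑[ j < n ] F i j
∑∑-symmetrise {n} F = begin
  ∑[ i < n ] ∑[ j < n ] (F i j + F j i)                   ≡⟨ sum-cong-≗ {n} (λ i → ∑-distrib-+ {n} (F i) _) ⟩
  ∑[ i < n ] (∑[ j < n ] F i j + ∑[ j < n ] F j i)        ≡⟨ ∑-distrib-+ {n} _ _ ⟩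
  T + ∑[ i < n ] ∑[ j < n ] F j i                          ≡⟨ cong (T +_) (∑-comm {n} {n} (λ i j → F j i)) ⟩
  T + T                                                    ≡⟨ cong (T +_) (sym (+-identityʳ T)) ⟩
  2 * T                                                    ∎
  where
  open ≡-Reasoning
  T = ∑[ i < n ] ∑[ j < n ] F i j

sum-tabulate : ∀ {n} (f : Fin n → ℕ) → List.sum (tabulate f) ≡ ∑ f
sum-tabulate {zero}  f = refl
sum-tabulate {suc n} f = cong (f fz +_) (sum-tabulate (f ∘ fs))

sum-map-allFin : ∀ n (g : Fin n → ℕ) → List.sum (map g (allFin n)) ≡ ∑ g
sum-map-allFin n g = trans (cong List.sum (map-tabulate id g)) (sum-tabulate g)

sum-map-filter : ∀ {A : Set} {P : Pred A 0ℓ} (P? : Decidable P) (g : A → ℕ) xs →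
  List.sum (map g (filter P? xs)) ≡ List.sum (map (λ x → if does (P? x) then g x else 0) xs)
sum-map-filter P? g []       = refl
sum-map-filter P? g (x ∷ xs) with does (P? x)
... | true  = cong (g x +_) (sum-map-filter P? g xs)
... | false = sum-map-filter P? g xs

sum-map-concatMap : ∀ {A B : Set} (g : B → ℕ) (f : A → List B) xs →
  List.sum (map g (concatMap f xs)) ≡ List.sum (map (λ x → List.sum (map g (f x))) xs)
sum-map-concatMap g f []       = refl
sum-map-concatMap g f (x ∷ xs) = begin
  List.sum (map g (f x ++ concatMap f xs))                   ≡⟨ cong List.sum (map-++ g (f x) _) ⟩
  List.sum (map g (f x) ++ map g (concatMap f xs))           ≡⟨ sum-++ (map g (f x)) _ ⟩
  List.sum (map g (f x)) + List.sum (map g (concatMap f xs)) ≡⟨ cong (_ +_) (sum-map-concatMap g f xs) ⟩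
  _                                                          ∎
  where open ≡-Reasoning

module _ {n : ℕ} (S : Fin n → Fin n → Bool) where

  upper : Fin n → Fin n → ℕ
  upper i j = if does (i Fin.<? j) then ⟦ S i j ⟧ else 0

  size≡∑upper : size S ≡ ∑[ i < n ] ∑[ j < n ] upper i j
  size≡∑upper = begin
    List.sum (map g (filter _ (concatMap row (allFin n))))
      ≡⟨ sum-map-filter _ g (concatMap row (allFin n)) ⟩
    List.sum (map (λ { (i , j) → upper i j }) (concatMap row (allFin n)))
      ≡⟨ sum-map-concatMap _ row (allFin n) ⟩
    List.sum (map (λ i → List.sum (map (λ { (i , j) → upper i j }) (row i))) (allFin n))
      ≡⟨ sum-map-allFin n _ ⟩
    ∑[ i < n ] List.sum (map (λ { (i , j) → upper i j }) (row i))
      ≡⟨ sum-cong-≗ {n} (λ i → trans (cong List.sum (sym (map-∘ (allFin n)))) (sum-map-allFin n (upper i))) ⟩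
    ∑[ i < n ] ∑[ j < n ] upper i j ∎
    where
    open ≡-Reasoning
    g : Fin n × Fin n → ℕ
    g (i , j) = if S i j then 1 else 0
    row : Fin n → List (Fin n × Fin n)
    row i = map (i ,_) (allFin n)

  degree : Fin n → ℕ
  degree i = count (S i)

  handshake : (∀ i j → S i j ≡ S j i) → (∀ i → S i i ≡ false) → 2 * size S ≡ ∑ degree
  handshake S-sym S-irrefl = begin
    2 * size S                                      ≡⟨ cong (2 *_) size≡∑upper ⟩
    2 * ∑[ i < n ] ∑[ j < n ] upper i j             ≡⟨ sym (∑∑-symmetrise upper) ⟩
    ∑[ i < n ] ∑[ j < n ] (upper i j + upper j i)   ≡⟨ sum-cong-≗ {n} (λ i → sum-cong-≗ {n} (λ j → split i j)) ⟩
    ∑ degree                                        ∎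
    where
    open ≡-Reasoning
    split : ∀ i j → upper i j + upper j i ≡ ⟦ S i j ⟧
    split i j with Fin.<-cmp i j
    ... | tri< i<j _ j≮i rewrite dec-true (i Fin.<? j) i<j | dec-false (j Fin.<? i) j≮i = +-identityʳ _
    ... | tri≈ i≮i refl _ rewrite dec-false (i Fin.<? i) i≮i | S-irrefl i = refl
    ... | tri> i≮j _ j<i rewrite dec-false (i Fin.<? j) i≮j | dec-true (j Fin.<? i) j<i = cong ⟦_⟧ (S-sym j i)

size-mono : ∀ {n} {S T : Fin n → Fin n → Bool} → (∀ i j → S i j ≡ true → T i j ≡ true) → size S ≤ size T
size-mono {n} {S} {T} S⊆T = subst₂ _≤_ (sym (size≡∑upper S)) (sym (size≡∑upper T))
  (∑-mono-≤ (λ i → ∑-mono-≤ (upper-mono i)))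
  where
  upper-mono : ∀ i j → upper S i j ≤ upper T i j
  upper-mono i j with does (i Fin.<? j)
  ... | false = z≤n
  ... | true with S i j in e
  ... | true rewrite S⊆T i j e = ≤-refl
  ... | false = z≤n


-- Matchings

EdgeSet : Graph → Set
EdgeSet G = Fin (n G) → Fin (n G) → Bool

module _ {k : ℕ} (M : Fin k → Fin k → Bool) where

  covered : Fin k → Bool
  covered v = does (Fin.any? (λ w → M v w Bool.≟ true))

  -- An uncovered vertex is its own (junk) mate.
  mate : Fin k → Fin k
  mate v with Fin.any? (λ w → M v w Bool.≟ true)
  ... | yes (w , _) = w
  ... | no _        = v

  mate-spec : ∀ v → covered v ≡ true → M v (mate v) ≡ true
  mate-spec v _ with Fin.any? (λ w → M v w Bool.≟ true)
  ... | yes (_ , Mvw) = Mvw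

  covered-intro : ∀ v w → M v w ≡ true → covered v ≡ true
  covered-intro v w Mvw = dec-true (Fin.any? (λ w → M v w Bool.≟ true)) (w , Mvw)

  uncovered : ∀ v w → covered v ≡ false → M v w ≡ false
  uncovered v w v-uncovered with M v w in Mvw
  ... | false = refl
  ... | true with () ← trans (sym (covered-intro v w Mvw)) v-uncovered

module _ (G : Graph) where
  private
    N = n G
    A = adj G

  adjacent⇒≢ : ∀ {x y} → A x y ≡ true → x ≢ y
  adjacent⇒≢ {x} Axy refl with () ← trans (sym Axy) (irrefl G x)

  module Matching {M : EdgeSet G} (isM : IsMatching G M) where

    M-sym : ∀ u v → M u v ≡ M v u
    M-sym = proj₁ (proj₁ isM)

    M⊆A : ∀ u v → M u v ≡ true → A u v ≡ true
    M⊆A = proj₂ (proj₁ isM)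

    M-functional : ∀ u v w → M u v ≡ true → M u w ≡ true → v ≡ w
    M-functional = proj₂ isM

    M-irrefl : ∀ v → M v v ≡ false
    M-irrefl v with M v v in Mvv
    ... | false = refl
    ... | true  = ⊥-elim (adjacent⇒≢ (M⊆A v v Mvv) refl)

    mate-unique : ∀ {v w} → M v w ≡ true → mate M v ≡ w
    mate-unique {v} {w} Mvw = M-functional v _ _ (mate-spec M v (covered-intro M v w Mvw)) Mvw

    mate-covered : ∀ v → covered M v ≡ true → covered M (mate M v) ≡ true
    mate-covered v cv = covered-intro M _ v (trans (M-sym _ _) (mate-spec M v cv))

    mate-involutive : ∀ v → covered M v ≡ true → mate M (mate M v) ≡ v
    mate-involutive v cv = mate-unique (trans (M-sym _ _) (mate-spec M v cv))

    mate-adjacent : ∀ v → covered M v ≡ true → A v (mate M v) ≡ true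
    mate-adjacent v cv = M⊆A _ _ (mate-spec M v cv)

    mate-≢ : ∀ v → covered M v ≡ true → mate M v ≢ v
    mate-≢ v cv = adjacent⇒≢ (mate-adjacent v cv) ∘ sym

    on : Fin N → Fin N → Bool
    on p x = (p == x) ∨ (mate M p == x)

    on-elim : ∀ {p x} → on p x ≡ true → x ≡ p ⊎ x ≡ mate M p
    on-elim {p} {x} on-px with ∨-true (p == x) on-px
    ... | inj₁ p==x = inj₁ (sym (==⇒≡ p==x))
    ... | inj₂ p′==x = inj₂ (sym (==⇒≡ p′==x))

    on-self : ∀ p → on p p ≡ true
    on-self p rewrite ==-refl p = refl

    on-mate : ∀ p → on p (mate M p) ≡ true
    on-mate p rewrite ==-refl (mate M p) = ∨-zeroʳ (p == mate M p)

    on-closed : ∀ {p x} → covered M p ≡ true → on p x ≡ true → on p (mate M x) ≡ true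
    on-closed {p} cp on-px with on-elim on-px
    ... | inj₁ refl = on-mate p
    ... | inj₂ refl rewrite mate-involutive p cp = on-self p

    on-covered : ∀ {p x} → covered M p ≡ true → on p x ≡ true → covered M x ≡ true
    on-covered {p} cp on-px with on-elim on-px
    ... | inj₁ refl = cp
    ... | inj₂ refl = mate-covered p cp

    on-adjacent : ∀ {p x y} → covered M p ≡ true → on p x ≡ true → on p y ≡ true → A x y ≡ true → mate M x ≡ y
    on-adjacent {p} cp on-x on-y Axy with on-elim on-x | on-elim on-y
    ... | inj₁ refl | inj₁ refl = ⊥-elim (adjacent⇒≢ Axy refl)
    ... | inj₁ refl | inj₂ refl = refl
    ... | inj₂ refl | inj₁ refl = mate-involutive p cp
    ... | inj₂ refl | inj₂ refl = ⊥-elim (adjacent⇒≢ Axy refl)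

    on-shared : ∀ {p w x} → covered M p ≡ true → covered M w ≡ true →
                on p x ≡ true → on w x ≡ true → on p w ≡ true
    on-shared {p} {w} cp cw on-px on-wx with on-elim on-wx
    ... | inj₁ refl = on-px
    ... | inj₂ refl = subst (λ t → on p t ≡ true) (mate-involutive w cw) (on-closed cp on-px)

    count-on : ∀ p → covered M p ≡ true → count (on p) ≡ 2
    count-on p cp = trans (count-∨-disjoint (p ==_) (mate M p ==_) disjoint)
                          (cong₂ _+_ (count-singleton p) (count-singleton (mate M p)))
      where
      disjoint : ∀ x → (p == x) ≡ true → (mate M p == x) ≡ false
      disjoint x p==x with refl ← ==⇒≡ {i = p} {x} p==x = ==-≢ (mate-≢ p cp)

    degree≡⟦covered⟧ : ∀ v → degree M v ≡ ⟦ covered M v ⟧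
    degree≡⟦covered⟧ v with covered M v in cv
    ... | true  = trans (sum-cong-≗ {N} (cong ⟦_⟧ ∘ M≡mate==)) (count-singleton (mate M v))
      where
      M≡mate== : ∀ w → M v w ≡ (mate M v == w)
      M≡mate== w with M v w in Mvw | mate M v Fin.≟ w
      ... | true  | yes _   = refl
      ... | true  | no ≢w   = ⊥-elim (≢w (mate-unique Mvw))
      ... | false | yes refl with () ← trans (sym Mvw) (mate-spec M v cv)
      ... | false | no _    = refl
    ... | false = ∑-zero {N} (λ w → cong ⟦_⟧ (uncovered M v w cv))

    2*size≡count-covered : 2 * size M ≡ count (covered M)
    2*size≡count-covered = trans (handshake M M-sym M-irrefl) (sum-cong-≗ {N} degree≡⟦covered⟧)

    2*size≤n : 2 * size M ≤ N
    2*size≤n = subst (_≤ N) (sym 2*size≡count-covered) (count≤n (covered M))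

    ∑-matched-pairs≤ : ∀ (F : Fin N → ℕ) → ∑[ v < N ] (⟦ covered M v ⟧ * (F v + F (mate M v))) ≤ 2 * ∑ F
    ∑-matched-pairs≤ F = begin
      ∑[ v < N ] (⟦ covered M v ⟧ * (F v + F (mate M v)))
        ≡⟨ sum-cong-≗ {N} (λ v → *-distribˡ-+ ⟦ covered M v ⟧ (F v) _) ⟩
      ∑[ v < N ] (⟦ covered M v ⟧ * F v + ⟦ covered M v ⟧ * F (mate M v))
        ≡⟨ ∑-distrib-+ {N} _ _ ⟩
      X + ∑[ v < N ] (⟦ covered M v ⟧ * F (mate M v))
        ≡⟨ cong (X +_) (∑-involution (mate M) F mate-covered mate-involutive) ⟩
      X + X
        ≡⟨ cong (X +_) (sym (+-identityʳ X)) ⟩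
      2 * X
        ≤⟨ *-monoʳ-≤ 2 (∑-mono-≤ (λ v → ⟦⟧*≤ (covered M v) (F v))) ⟩
      2 * ∑ F ∎
      where
      open ≤-Reasoning
      X = ∑[ v < N ] (⟦ covered M v ⟧ * F v)

  record Pairing : Set where
    field
      paired             : Fin N → Bool
      partner            : Fin N → Fin N
      partner-paired     : ∀ u → paired u ≡ true → paired (partner u) ≡ true
      partner-involutive : ∀ u → paired u ≡ true → partner (partner u) ≡ u
      partner-adjacent   : ∀ u → paired u ≡ true → A u (partner u) ≡ true

    matching : EdgeSet G
    matching u v = paired u ∧ (partner u == v)

    matching-elim : ∀ {u v} → matching u v ≡ true → paired u ≡ true × partner u ≡ v
    matching-elim {u} e with ∧-true (paired u) e
    ... | pu , partner==v = pu , ==⇒≡ partner==v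

    matching-intro : ∀ u → paired u ≡ true → matching u (partner u) ≡ true
    matching-intro u pu rewrite pu = ==-refl (partner u)

    private
      matching-flip : ∀ {u v} → matching u v ≡ true → matching v u ≡ true
      matching-flip {u} e with matching-elim e
      ... | pu , refl = subst (λ w → matching (partner u) w ≡ true) (partner-involutive u pu)
                              (matching-intro (partner u) (partner-paired u pu))

    matching-sym : ∀ u v → matching u v ≡ matching v u
    matching-sym u v = ⇔→≡ {z = true} (mk⇔ matching-flip matching-flip)

    isMatching : IsMatching G matching
    isMatching = (matching-sym , ⊆A) , λ u v w e e′ → trans (sym (proj₂ (matching-elim e))) (proj₂ (matching-elim e′))
      where
      ⊆A : ∀ u v → matching u v ≡ true → A u v ≡ true
      ⊆A u v e with matching-elim e
      ... | pu , refl = partner-adjacent u pu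

    covered≡paired : ∀ u → covered matching u ≡ paired u
    covered≡paired u = ⇔→≡ {z = true} (mk⇔ (λ cu → proj₁ (matching-elim (mate-spec matching u cu)))
                                             (λ pu → covered-intro matching u _ (matching-intro u pu)))

    2*size≡count-paired : 2 * size matching ≡ count paired
    2*size≡count-paired = trans (Matching.2*size≡count-covered isMatching) (sum-cong-≗ {N} (cong ⟦_⟧ ∘ covered≡paired))

  module AddEdge {M : EdgeSet G} (isM : IsMatching G M) {u v : Fin N} (Auv : A u v ≡ true)
                 (u-free : covered M u ≡ false) (v-free : covered M v ≡ false) where
    open Matching isM

    paired : Fin N → Bool
    paired x = covered M x ∨ (x == u ∨ x == v)

    partner : Fin N → Fin N
    partner x = if covered M x then mate M x else (if x == u then v else u)

    classify : ∀ x → paired x ≡ true → covered M x ≡ true ⊎ (x ≡ u ⊎ x ≡ v)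
    classify x px with ∨-true (covered M x) px
    ... | inj₁ cx = inj₁ cx
    ... | inj₂ e with ∨-true (x == u) e
    ... | inj₁ x==u = inj₂ (inj₁ (==⇒≡ x==u))
    ... | inj₂ x==v = inj₂ (inj₂ (==⇒≡ x==v))

    covered⇒paired : ∀ {x} → covered M x ≡ true → paired x ≡ true
    covered⇒paired cx rewrite cx = refl

    u-paired : paired u ≡ true
    u-paired rewrite ==-refl u | u-free = refl

    v-paired : paired v ≡ true
    v-paired rewrite ==-refl v | v-free = ∨-zeroʳ (v == u)

    partner-covered : ∀ {x} → covered M x ≡ true → partner x ≡ mate M x
    partner-covered cx rewrite cx = refl

    partner-u : partner u ≡ v
    partner-u rewrite u-free | ==-refl u = refl

    partner-v : partner v ≡ u
    partner-v rewrite v-free | ==-≢ (adjacent⇒≢ Auv ∘ sym) = refl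

    pairing : Pairing
    pairing = record
      { paired = paired ; partner = partner
      ; partner-paired = partner-paired ; partner-involutive = partner-involutive
      ; partner-adjacent = partner-adjacent }
      where
      partner-paired : ∀ x → paired x ≡ true → paired (partner x) ≡ true
      partner-paired x px with classify x px
      ... | inj₁ cx rewrite partner-covered cx = covered⇒paired (mate-covered x cx)
      ... | inj₂ (inj₁ refl) rewrite partner-u = v-paired
      ... | inj₂ (inj₂ refl) rewrite partner-v = u-paired

      partner-involutive : ∀ x → paired x ≡ true → partner (partner x) ≡ x
      partner-involutive x px with classify x px
      ... | inj₁ cx rewrite partner-covered cx | partner-covered (mate-covered x cx) = mate-involutive x cx
      ... | inj₂ (inj₁ refl) rewrite partner-u = partner-v
      ... | inj₂ (inj₂ refl) rewrite partner-v = partner-u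

      partner-adjacent : ∀ x → paired x ≡ true → A x (partner x) ≡ true
      partner-adjacent x px with classify x px
      ... | inj₁ cx rewrite partner-covered cx = mate-adjacent x cx
      ... | inj₂ (inj₁ refl) rewrite partner-u = Auv
      ... | inj₂ (inj₂ refl) rewrite partner-v = trans (Graph.sym G v u) Auv

    open Pairing pairing using (matching; matching-intro)

    M⊆matching : ∀ x y → M x y ≡ true → matching x y ≡ true
    M⊆matching x y Mxy = subst (λ z → matching x z ≡ true) (trans (partner-covered cx) (mate-unique Mxy))
                               (matching-intro x (covered⇒paired cx))
      where cx = covered-intro M x y Mxy

    uv∈matching : matching u v ≡ true
    uv∈matching = subst (λ z → matching u z ≡ true) partner-u (matching-intro u u-paired)

  maximal⇒covers : ∀ {M} → IsMaximalMatching G M →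
    ∀ u v → A u v ≡ true → covered M u ≡ true ⊎ covered M v ≡ true
  maximal⇒covers {M} (isM , maximal) u v Auv with covered M u in cu | covered M v in cv
  ... | true  | _    = inj₁ refl
  ... | false | true = inj₂ refl
  ... | false | false = ⊥-elim (maximal matching isMatching
        (M⊆matching , u , v , uv∈matching , not-¬ (uncovered M u v cu)))
    where
    open AddEdge isM Auv cu cv
    open Pairing pairing using (matching; isMatching)

  covers⇒maximal : ∀ {M} → IsMatching G M →
    (∀ u v → A u v ≡ true → covered M u ≡ true ⊎ covered M v ≡ true) → IsMaximalMatching G M
  covers⇒maximal {M} isM covers =
    isM , λ M′ isM′ (M⊆M′ , i , j , M′ij , ¬Mij) → ¬Mij (M′⊆M M′ isM′ M⊆M′ i j M′ij)
    where
    open Matching isM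
    M′⊆M : ∀ M′ → IsMatching G M′ → (∀ i j → M i j ≡ true → M′ i j ≡ true) →
           ∀ i j → M′ i j ≡ true → M i j ≡ true
    M′⊆M M′ isM′ M⊆M′ i j M′ij with covers i j (Matching.M⊆A isM′ i j M′ij)
    ... | inj₁ ci = subst (λ x → M i x ≡ true)
                          (Matching.M-functional isM′ i _ _ (M⊆M′ _ _ (mate-spec M i ci)) M′ij) (mate-spec M i ci)
    ... | inj₂ cj = trans (M-sym i j) (subst (λ x → M j x ≡ true)
                          (Matching.M-functional isM′ j _ _ (M⊆M′ _ _ (mate-spec M j cj))
                                                 (trans (Matching.M-sym isM′ j i) M′ij)) (mate-spec M j cj))

  SameEdge : (a b c d : Fin N) → Set
  SameEdge a b c d = (a ≡ c × b ≡ d) ⊎ (a ≡ d × b ≡ c)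

  SameEdge-flip : ∀ {a b c d} → SameEdge a b c d → SameEdge b a c d
  SameEdge-flip (inj₁ (p , q)) = inj₂ (q , p)
  SameEdge-flip (inj₂ (p , q)) = inj₁ (q , p)

  SameEdge-join : ∀ {a b c d x w} → SameEdge x w a b → SameEdge x w c d → SameEdge a b c d
  SameEdge-join (inj₁ (refl , refl)) (inj₁ (refl , refl)) = inj₁ (refl , refl)
  SameEdge-join (inj₁ (refl , refl)) (inj₂ (refl , refl)) = inj₂ (refl , refl)
  SameEdge-join (inj₂ (refl , refl)) (inj₁ (refl , refl)) = inj₂ (refl , refl)
  SameEdge-join (inj₂ (refl , refl)) (inj₂ (refl , refl)) = inj₁ (refl , refl)

  module _ {M : EdgeSet G} (isM : IsMatching G M) where
    open Matching isM

    other-endpoint : ∀ {a b z} → M a b ≡ true → z ∈E (a , b) → ∃[ w ] M z w ≡ true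
    other-endpoint {a} {b} Mab (inj₁ refl) = b , Mab
    other-endpoint {a} {b} Mab (inj₂ refl) = a , trans (M-sym b a) Mab

    edge-at-endpoint : ∀ {a b z w} → M a b ≡ true → z ∈E (a , b) → M z w ≡ true → SameEdge z w a b
    edge-at-endpoint {a} Mab (inj₁ refl) Mzw = inj₁ (refl , M-functional a _ _ Mzw Mab)
    edge-at-endpoint {a} {b} Mab (inj₂ refl) Mzw = inj₂ (refl , M-functional b _ _ Mzw (trans (M-sym b a) Mab))

    closed⇒induced : (∀ x y → covered M x ≡ true → covered M y ≡ true → A x y ≡ true → M x y ≡ true) →
                     IsInducedMatching G M
    closed⇒induced closed = isM , no-link
      where
      covered-endpoint : ∀ {a b z} → M a b ≡ true → z ∈E (a , b) → covered M z ≡ true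
      covered-endpoint Mab z∈ab = let (w , Mzw) = other-endpoint Mab z∈ab in covered-intro M _ w Mzw

      shared : ∀ {a b c d z} → M a b ≡ true → M c d ≡ true → z ∈E (a , b) → z ∈E (c , d) → SameEdge a b c d
      shared Mab Mcd z∈ab z∈cd = let (w , Mzw) = other-endpoint Mab z∈ab in
        SameEdge-join (edge-at-endpoint Mab z∈ab Mzw) (edge-at-endpoint Mcd z∈cd Mzw)

      linked : ∀ {a b c d x y} → M a b ≡ true → M c d ≡ true → x ∈E (a , b) → y ∈E (c , d) →
               A x y ≡ true → SameEdge a b c d
      linked Mab Mcd x∈ab y∈cd Axy =
        let Mxy = closed _ _ (covered-endpoint Mab x∈ab) (covered-endpoint Mcd y∈cd) Axy in
        SameEdge-join (edge-at-endpoint Mab x∈ab Mxy)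
                      (SameEdge-flip (edge-at-endpoint Mcd y∈cd (trans (M-sym _ _) Mxy)))

      no-link : ∀ a b c d → M a b ≡ true → M c d ≡ true → ¬ SameEdge a b c d →
        ¬ (∃[ x ] ∃[ y ] (A x y ≡ true × (x ∈E (a , b) ⊎ y ∈E (a , b)) × (x ∈E (c , d) ⊎ y ∈E (c , d))))
      no-link a b c d Mab Mcd ¬same (x , y , Axy , inj₁ x∈ab , inj₁ x∈cd) = ¬same (shared Mab Mcd x∈ab x∈cd)
      no-link a b c d Mab Mcd ¬same (x , y , Axy , inj₂ y∈ab , inj₂ y∈cd) = ¬same (shared Mab Mcd y∈ab y∈cd)
      no-link a b c d Mab Mcd ¬same (x , y , Axy , inj₁ x∈ab , inj₂ y∈cd) = ¬same (linked Mab Mcd x∈ab y∈cd Axy)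
      no-link a b c d Mab Mcd ¬same (x , y , Axy , inj₂ y∈ab , inj₁ x∈cd) =
        ¬same (linked Mab Mcd y∈ab x∈cd (trans (Graph.sym G y x) Axy))

  induced⇒closed : ∀ {M} → IsInducedMatching G M → ∀ {x x′ y y′} → M x x′ ≡ true → M y y′ ≡ true →
                   A x y ≡ true → M x y ≡ true
  induced⇒closed {M} (isM , induced) {x} {x′} {y} {y′} Mxx′ Myy′ Axy with M x y in Mxy
  ... | true  = refl
  ... | false = ⊥-elim (induced x x′ y y′ Mxx′ Myy′ ¬same (x , y , Axy , inj₁ (inj₁ refl) , inj₂ (inj₁ refl)))
    where
    ¬same : ¬ SameEdge x x′ y y′
    ¬same (inj₁ (x≡y , _)) = adjacent⇒≢ Axy x≡y
    ¬same (inj₂ (_ , refl)) with () ← trans (sym Mxy) Mxx′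

  module TwoEdges {M : EdgeSet G} (isM : IsMatching G M) {v w : Fin N}
                  (cv : covered M v ≡ true) (cw : covered M w ≡ true) (w∉v : Matching.on isM v w ≡ false) where
    open Matching isM

    paired : Fin N → Bool
    paired x = on v x ∨ on w x

    paired-elim : ∀ {x} → paired x ≡ true → on v x ≡ true ⊎ on w x ≡ true
    paired-elim {x} = ∨-true (on v x)

    paired⇒covered : ∀ {x} → paired x ≡ true → covered M x ≡ true
    paired⇒covered px = [ on-covered cv , on-covered cw ]′ (paired-elim px)

    paired-closed : ∀ x → paired x ≡ true → paired (mate M x) ≡ true
    paired-closed x px with paired-elim px
    ... | inj₁ on-vx rewrite on-closed cv on-vx = refl
    ... | inj₂ on-wx rewrite on-closed cw on-wx = ∨-zeroʳ _

    pairing : Pairing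
    pairing = record
      { paired = paired ; partner = mate M ; partner-paired = paired-closed
      ; partner-involutive = λ x px → mate-involutive x (paired⇒covered px)
      ; partner-adjacent = λ x px → mate-adjacent x (paired⇒covered px) }

    open Pairing pairing public using (matching; isMatching)
    open Pairing pairing using (matching-intro; covered≡paired; 2*size≡count-paired)

    size≡2 : size matching ≡ 2
    size≡2 = *-cancelˡ-≡ _ _ 2 (trans 2*size≡count-paired
               (trans (count-∨-disjoint (on v) (on w) disjoint) (cong₂ _+_ (count-on v cv) (count-on w cw))))
      where
      disjoint : ∀ x → on v x ≡ true → on w x ≡ false
      disjoint x on-vx with on w x in on-wx
      ... | false = refl
      ... | true with () ← trans (sym w∉v) (on-shared cv cw on-vx on-wx)

    induced : (∀ x y → on v x ≡ true → on w y ≡ true → A x y ≡ false) → IsInducedMatching G matching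
    induced unlinked = closed⇒induced isMatching closed
      where
      closed : ∀ x y → covered matching x ≡ true → covered matching y ≡ true → A x y ≡ true → matching x y ≡ true
      closed x y cx cy Axy =
        subst (λ t → matching x t ≡ true) (same-edge (paired-elim px) (paired-elim py)) (matching-intro x px)
        where
        px = trans (sym (covered≡paired x)) cx
        py = trans (sym (covered≡paired y)) cy
        same-edge : on v x ≡ true ⊎ on w x ≡ true → on v y ≡ true ⊎ on w y ≡ true → mate M x ≡ y
        same-edge (inj₁ vx) (inj₁ vy) = on-adjacent cv vx vy Axy
        same-edge (inj₂ wx) (inj₂ wy) = on-adjacent cw wx wy Axy
        same-edge (inj₁ vx) (inj₂ wy) = ⊥-elim (not-¬ (unlinked x y vx wy) Axy)
        same-edge (inj₂ wx) (inj₁ vy) = ⊥-elim (not-¬ (unlinked y x vy wx) (trans (Graph.sym G y x) Axy))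

  induced≤maximal : ∀ {I M} → IsInducedMatching G I → IsMaximalMatching G M → size I ≤ size M
  induced≤maximal {I} {M} isI maxM = *-cancelˡ-≤ 2 (subst₂ _≤_ (sym I.2*size≡count-covered) (sym M.2*size≡count-covered)
                                                   (count-inject-≤ ψ ψ-covered ψ-injective))
    where
    module I = Matching (proj₁ isI)
    module M = Matching (proj₁ maxM)

    -- An I-covered vertex missed by M is sent to the M-mate of its I-mate; as I is induced, ψ is injective.
    ψ : Fin N → Fin N
    ψ v = if covered M v then v else mate M (mate I v)

    mate-rescued : ∀ v → covered I v ≡ true → covered M v ≡ false → covered M (mate I v) ≡ true
    mate-rescued v cIv cMv with maximal⇒covers maxM v (mate I v) (I.mate-adjacent v cIv)
    ... | inj₁ cMv′ with () ← trans (sym cMv) cMv′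
    ... | inj₂ cM = cM

    ψ-covered : ∀ v → covered I v ≡ true → covered M (ψ v) ≡ true
    ψ-covered v cIv with covered M v in cMv
    ... | true  = cMv
    ... | false = M.mate-covered _ (mate-rescued v cIv cMv)

    mixed : ∀ v w → covered I v ≡ true → covered I w ≡ true → covered M v ≡ true → covered M w ≡ false →
            v ≢ mate M (mate I w)
    mixed v w cIv cIw cMv cMw v≡ = not-¬ cMw (subst (λ t → covered M t ≡ true) v≡w cMv)
      where
      w′ = mate I w
      Mw′v : M w′ v ≡ true
      Mw′v = subst (λ t → M w′ t ≡ true) (sym v≡) (mate-spec M w′ (mate-rescued w cIw cMw))
      Iw′v : I w′ v ≡ true
      Iw′v = induced⇒closed isI (trans (I.M-sym _ _) (mate-spec I w cIw)) (mate-spec I v cIv) (M.M⊆A _ _ Mw′v)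
      v≡w : v ≡ w
      v≡w = trans (sym (I.mate-unique Iw′v)) (I.mate-involutive w cIw)

    ψ-injective : ∀ v w → covered I v ≡ true → covered I w ≡ true → ψ v ≡ ψ w → v ≡ w
    ψ-injective v w cIv cIw ψv≡ψw with covered M v in cMv | covered M w in cMw
    ... | true  | true  = ψv≡ψw
    ... | true  | false = ⊥-elim (mixed v w cIv cIw cMv cMw ψv≡ψw)
    ... | false | true  = ⊥-elim (mixed w v cIw cIv cMw cMv (sym ψv≡ψw))
    ... | false | false = trans (sym (I.mate-involutive v cIv)) (trans (cong (mate I) I-mates≡) (I.mate-involutive w cIw))
      where
      I-mates≡ : mate I v ≡ mate I w
      I-mates≡ = trans (sym (M.mate-involutive _ (mate-rescued v cIv cMv)))
                       (trans (cong (mate M) ψv≡ψw) (M.mate-involutive _ (mate-rescued w cIw cMw)))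

pendant⇒covered : ∀ G {M} → IsMaximalMatching G M → ∀ {u b} → adj G u b ≡ true →
  (∀ x → adj G b x ≡ true → x ≡ u) → covered M u ≡ true
pendant⇒covered G {M} maxM {u} {b} Aub only-u with maximal⇒covers G maxM u b Aub
... | inj₁ cu = cu
... | inj₂ cb = covered-intro M u b (trans (M-sym u b)
                  (subst (λ t → M b t ≡ true) (only-u _ (mate-adjacent b cb)) (mate-spec M b cb)))
  where open Matching G (proj₁ maxM)

module _ (G : Graph) (hub : Fin (n G) → Bool)
         (edge-meets-hub : ∀ u v → adj G u v ≡ true → hub u ≡ true ⊎ hub v ≡ true)
         (hubs-adjacent : ∀ u v → hub u ≡ true → hub v ≡ true → u ≢ v → adj G u v ≡ true)
         {I : EdgeSet G} (isI : IsInducedMatching G I) where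
  open Matching G (proj₁ isI)

  private
    hub-end : Fin (n G) → Fin (n G)
    hub-end x = if hub x then x else mate I x

    hub-end-on : ∀ x → on x (hub-end x) ≡ true
    hub-end-on x with hub x
    ... | true  = on-self x
    ... | false = on-mate x

    hub-end-hub : ∀ x → covered I x ≡ true → hub (hub-end x) ≡ true
    hub-end-hub x cx with hub x in hx
    ... | true  = hx
    ... | false with edge-meets-hub x (mate I x) (mate-adjacent x cx)
    ...   | inj₁ hx′ with () ← trans (sym hx) hx′
    ...   | inj₂ hmx = hmx

    -- Distinct edges of I have distinct hub endpoints, which would be adjacent.
    single-edge : ∀ v w → covered I v ≡ true → covered I w ≡ true → on v w ≡ true
    single-edge v w cv cw with hub-end v Fin.≟ hub-end w
    ... | yes hv≡hw = on-shared cv cw (hub-end-on v) (subst (λ t → on w t ≡ true) (sym hv≡hw) (hub-end-on w))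
    ... | no  hv≢hw = on-shared cv cw (subst (λ t → on v t ≡ true) (mate-unique Ihvhw) (on-closed cv (hub-end-on v)))
                                      (hub-end-on w)
      where
      Ihvhw = induced⇒closed G isI (mate-spec I _ (on-covered cv (hub-end-on v)))
                                   (mate-spec I _ (on-covered cw (hub-end-on w)))
                                   (hubs-adjacent _ _ (hub-end-hub v cv) (hub-end-hub w cw) hv≢hw)

  hub-cover⇒induced≤1 : size I ≤ 1
  hub-cover⇒induced≤1 with Fin.any? (λ v → covered I v Bool.≟ true)
  ... | no none = *-cancelˡ-≤ 2 (≤-trans (≤-reflexive (trans 2*size≡count-covered (∑-zero {n G} nothing-covered))) z≤n)
    where
    nothing-covered : ∀ v → ⟦ covered I v ⟧ ≡ 0
    nothing-covered v with covered I v in cv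
    ... | true  = ⊥-elim (none (v , cv))
    ... | false = refl
  ... | yes (v , cv) = *-cancelˡ-≤ 2 (begin
    2 * size I          ≡⟨ 2*size≡count-covered ⟩
    count (covered I)   ≤⟨ count-mono (λ w cw → single-edge v w cv cw) ⟩
    count (on v)        ≡⟨ count-on v cv ⟩
    2                   ∎)
    where open ≤-Reasoning

induced-and-maximal⇒ind≡min : ∀ G {I X} q → IsInducedMatching G I → size I ≡ q →
  IsMaximalMatching G X → size X ≡ q → IndMatchNum G q × MinMatchNum G q
induced-and-maximal⇒ind≡min G q isI |I|≡q maxX |X|≡q =
  ((_ , isI , |I|≡q) , λ I′ isI′ → subst (size I′ ≤_) |X|≡q (induced≤maximal G isI′ maxX)) ,
  ((_ , maxX , |X|≡q) , λ X′ maxX′ → subst (_≤ size X′) |I|≡q (induced≤maximal G isI maxX′))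

near-perfect⇒MatchNum : ∀ G {P} r → IsMatching G P → size P ≡ r → n G ≤ suc (2 * r) → MatchNum G r
near-perfect⇒MatchNum G r isP |P|≡r n≤2r+1 = (_ , isP , |P|≡r) , λ M isM →
  ≤-pred (*-cancelˡ-< 2 _ _ (≤-trans (s≤s (≤-trans (Matching.2*size≤n G isM) n≤2r+1))
                                     (≤-reflexive (sym (*-suc 2 r)))))


-- Connectivity and spanning trees

star-exit : ∀ {k} {R : Fin k → Fin k → Set} (S : Fin k → Bool) {a w} → Star R a w → S a ≡ true → S w ≡ false →
  ∃[ x ] ∃[ y ] (S x ≡ true × S y ≡ false × R x y)
star-exit S ε Sa Sw with () ← trans (sym Sa) Sw
star-exit S {a} (_◅_ {j = j} Raj rest) Sa Sw with S j in Sj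
... | true  = star-exit S rest Sj Sw
... | false = a , j , Sa , Sj , Raj

descent⇒connected : ∀ (G : Graph) (root : Fin (n G)) (parent : Fin (n G) → Fin (n G)) (rank : Fin (n G) → ℕ) →
  (∀ v → v ≡ root ⊎ (adj G v (parent v) ≡ true × rank (parent v) < rank v)) → Connected G
descent⇒connected G root parent rank descent u v =
  path-to-root u ◅◅ reverse (λ {i} {j} Aij → trans (Graph.sym G j i) Aij) (path-to-root v)
  where
  path-within : ∀ k v → rank v < k → Star (λ i j → adj G i j ≡ true) v root
  path-within (suc k) v rv<k with descent v
  ... | inj₁ refl = ε
  ... | inj₂ (Avp , rp<rv) = Avp ◅ path-within k (parent v) (≤-trans rp<rv (≤-pred rv<k))
  path-to-root : ∀ v → Star (λ i j → adj G i j ≡ true) v root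
  path-to-root v = path-within (suc (rank v)) v ≤-refl

record RootedTree (N : ℕ) : Set where
  field
    root            : Fin N
    parent          : Fin N → Fin N
    rank            : Fin N → ℕ
    parent-descends : ∀ v → v ≢ root → rank (parent v) < rank v

  child-of : Fin N → Fin N → Bool
  child-of u v = not (u == root) ∧ (parent u == v)

  child-of-elim : ∀ {u v} → child-of u v ≡ true → u ≢ root × parent u ≡ v
  child-of-elim {u} e with u Fin.≟ root
  ... | no u≢root = u≢root , ==⇒≡ e

  child-of-parent : ∀ u → u ≢ root → child-of u (parent u) ≡ true
  child-of-parent u u≢root rewrite ==-≢ u≢root = ==-refl (parent u)

  child-of-irrefl : ∀ u → child-of u u ≡ false
  child-of-irrefl u with child-of u u in e
  ... | false = refl
  ... | true with child-of-elim e
  ... | u≢root , pu≡u = ⊥-elim (<-irrefl (cong rank pu≡u) (parent-descends u u≢root))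

  child-of-asym : ∀ u v → child-of u v ≡ true → child-of v u ≡ true → ⊥
  child-of-asym u v uv vu with child-of-elim uv | child-of-elim vu
  ... | u≢root , refl | pu≢root , ppu≡u =
    <-asym (parent-descends u u≢root) (subst (λ t → rank t < rank (parent u)) ppu≡u (parent-descends (parent u) pu≢root))

  tree-adj : Fin N → Fin N → Bool
  tree-adj u v = child-of u v ∨ child-of v u

  graph : Graph
  graph = record
    { n = N ; adj = tree-adj
    ; sym = λ u v → ∨-comm (child-of u v) (child-of v u)
    ; irrefl = λ u → cong (λ b → b ∨ b) (child-of-irrefl u) }

  tree-adj-elim : ∀ {u v} → tree-adj u v ≡ true → (u ≢ root × parent u ≡ v) ⊎ (v ≢ root × parent v ≡ u)
  tree-adj-elim {u} {v} e with ∨-true (child-of u v) e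
  ... | inj₁ uv = inj₁ (child-of-elim uv)
  ... | inj₂ vu = inj₂ (child-of-elim vu)

  tree-adj-parent : ∀ u → u ≢ root → tree-adj u (parent u) ≡ true
  tree-adj-parent u u≢root rewrite child-of-parent u u≢root = refl

  connected : Connected graph
  connected = descent⇒connected graph root parent rank descent
    where
    descent : ∀ v → v ≡ root ⊎ (tree-adj v (parent v) ≡ true × rank (parent v) < rank v)
    descent v = descend (v Fin.≟ root)
      where
      descend : Dec (v ≡ root) → v ≡ root ⊎ (tree-adj v (parent v) ≡ true × rank (parent v) < rank v)
      descend (yes v≡root) = inj₁ v≡root
      descend (no v≢root)  = inj₂ (tree-adj-parent v v≢root , parent-descends v v≢root)

  numEdges-tree : numEdges graph ≡ N ∸ 1
  numEdges-tree = *-cancelˡ-≡ _ _ 2 (begin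
    2 * size tree-adj                                           ≡⟨ handshake tree-adj (Graph.sym graph) (irrefl graph) ⟩
    ∑[ u < N ] ∑[ v < N ] ⟦ tree-adj u v ⟧                      ≡⟨ sum-cong-≗ {N} (λ u → sum-cong-≗ {N} (split u)) ⟩
    ∑[ u < N ] ∑[ v < N ] (⟦ child-of u v ⟧ + ⟦ child-of v u ⟧) ≡⟨ ∑∑-symmetrise (λ u v → ⟦ child-of u v ⟧) ⟩
    2 * ∑[ u < N ] count (child-of u)                           ≡⟨ cong (2 *_) (sum-cong-≗ {N} one-parent) ⟩
    2 * count (λ u → not (u == root))                           ≡⟨ cong (2 *_) (count-≢ root) ⟩
    2 * (N ∸ 1)                                                 ∎)
    where
    open ≡-Reasoning
    split : ∀ u v → ⟦ tree-adj u v ⟧ ≡ ⟦ child-of u v ⟧ + ⟦ child-of v u ⟧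
    split u v with child-of u v in uv | child-of v u in vu
    ... | true  | true  = ⊥-elim (child-of-asym u v uv vu)
    ... | true  | false = refl
    ... | false | true  = refl
    ... | false | false = refl
    one-parent : ∀ u → count (child-of u) ≡ ⟦ not (u == root) ⟧
    one-parent u with u == root
    ... | true  = ∑0 N
    ... | false = count-singleton (parent u)

module BreadthFirst (G : Graph) (conn : Connected G) (root : Fin (n G)) where
  private
    N = n G
    A = adj G
    exists : (Fin N → Bool) → Bool
    exists f = does (Fin.any? (λ u → f u Bool.≟ true))

  within : ℕ → Fin N → Bool
  within zero    v = v == root
  within (suc k) v = within k v ∨ exists (λ u → within k u ∧ A u v)

  within-mono : ∀ {j k} v → j ≤ k → within j v ≡ true → within k v ≡ true
  within-mono {k = zero}  v z≤n w = w
  within-mono {k = suc k} v j≤k w with m≤n⇒m<n∨m≡n j≤k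
  ... | inj₂ refl = w
  ... | inj₁ j<sk rewrite within-mono v (≤-pred j<sk) w = refl

  within-step : ∀ {u v} k → within k u ≡ true → A u v ≡ true → within (suc k) v ≡ true
  within-step {u} {v} k wu Auv
    rewrite dec-true (Fin.any? (λ x → (within k x ∧ A x v) Bool.≟ true)) (u , cong₂ _∧_ wu Auv) = ∨-zeroʳ (within k v)

  reachable : ∀ {u v} → Star (λ i j → A i j ≡ true) u v →
              ∀ k → within k u ≡ true → ∃[ k′ ] within k′ v ≡ true
  reachable ε         k w = k , w
  reachable (Auw ◅ p) k w = reachable p (suc k) (within-step k w Auw)

  first-within : ∀ v L → within L v ≡ true → ∃[ k ] (within k v ≡ true × (∀ {j} → j < k → within j v ≡ false))
  first-within v zero    w = zero , w , λ ()
  first-within v (suc L) w with within L v in wL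
  ... | true  = first-within v L wL
  ... | false = suc L , subst (λ b → b ∨ exists (λ u → within L u ∧ A u v) ≡ true) (sym wL) w , earlier
    where
    earlier : ∀ {j} → j < suc L → within j v ≡ false
    earlier {j} j<sL with within j v in wj
    ... | false = refl
    ... | true with () ← trans (sym (within-mono v (≤-pred j<sL) wj)) wL

  level-data : ∀ v → ∃[ k ] (within k v ≡ true × (∀ {j} → j < k → within j v ≡ false))
  level-data v = let (L , wL) = reachable (conn root v) 0 (==-refl root) in first-within v L wL

  level : Fin N → ℕ
  level v = proj₁ (level-data v)

  level-least : ∀ v j → within j v ≡ true → level v ≤ j
  level-least v j wj with level v <? suc j
  ... | yes l<sj = ≤-pred l<sj
  ... | no  l≮sj = ⊥-elim (not-¬ (proj₂ (proj₂ (level-data v)) (≰⇒> (l≮sj ∘ s≤s))) wj)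

  predecessor : ∀ v k → within k v ≡ true → (∀ {j} → j < k → within j v ≡ false) → v ≢ root →
                ∃[ u ] (A u v ≡ true × level u < k)
  predecessor v zero    w _ v≢root = ⊥-elim (v≢root (==⇒≡ w))
  predecessor v (suc m) w fresh v≢root with ∨-true (within m v) w
  ... | inj₁ wm with () ← trans (sym wm) (fresh ≤-refl)
  ... | inj₂ e with Fin.any? (λ u → (within m u ∧ A u v) Bool.≟ true)
  ... | yes (u , wu∧Auv) = let (wu , Auv) = ∧-true (within m u) wu∧Auv in u , Auv , s≤s (level-least u m wu)

  parent : Fin N → Fin N
  parent v with v Fin.≟ root
  ... | yes _    = root
  ... | no v≢root = let (k , w , fresh) = level-data v in proj₁ (predecessor v k w fresh v≢root)

  parent-spec : ∀ v → v ≢ root → A (parent v) v ≡ true × level (parent v) < level v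
  parent-spec v v≢root with v Fin.≟ root
  ... | yes v≡root = ⊥-elim (v≢root v≡root)
  ... | no v≢root′ = let (k , w , fresh) = level-data v in proj₂ (predecessor v k w fresh v≢root′)

  tree : RootedTree N
  tree = record
    { root = root ; parent = parent ; rank = level
    ; parent-descends = λ v v≢root → proj₂ (parent-spec v v≢root) }

  n∸1≤numEdges : N ∸ 1 ≤ numEdges G
  n∸1≤numEdges = subst (_≤ numEdges G) (RootedTree.numEdges-tree tree) (size-mono tree⊆G)
    where
    tree⊆G : ∀ i j → RootedTree.tree-adj tree i j ≡ true → A i j ≡ true
    tree⊆G i j e with RootedTree.tree-adj-elim tree {i} {j} e
    ... | inj₁ (i≢root , refl) = trans (Graph.sym G i _) (proj₁ (parent-spec i i≢root))
    ... | inj₂ (j≢root , refl) = proj₁ (parent-spec j j≢root)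

connected⇒n∸1≤numEdges : ∀ G → Connected G → Fin (n G) → n G ∸ 1 ≤ numEdges G
connected⇒n∸1≤numEdges G conn root = BreadthFirst.n∸1≤numEdges G conn root

module _ (G : Graph) (conn : Connected G) {I : EdgeSet G} (isI : IsInducedMatching G I)
         (all-covered : ∀ v → covered I v ≡ true) (a : Fin (n G)) where
  open Matching G (proj₁ isI)

  private
    mate-of-neighbour : ∀ {x y} → adj G x y ≡ true → mate I x ≡ y
    mate-of-neighbour {x} {y} Axy =
      mate-unique (induced⇒closed G isI (mate-spec I x (all-covered x)) (mate-spec I y (all-covered y)) Axy)

    -- An edge leaving the I-edge through a would join two I-covered vertices, so it would lie in I.
    on-a-everywhere : ∀ w → on a w ≡ true
    on-a-everywhere w with on a w in off
    ... | true  = refl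
    ... | false with star-exit (on a) (conn a w) (on-self a) off
    ...   | x , y , on-x , off-y , Axy =
            ⊥-elim (not-¬ off-y (subst (λ t → on a t ≡ true) (mate-of-neighbour Axy) (on-closed (all-covered a) on-x)))

  perfect-induced⇒n≤2 : n G ≤ 2
  perfect-induced⇒n≤2 = begin
    n G                      ≡⟨ sym (∑-1 (n G)) ⟩
    count {n G} (λ _ → true) ≤⟨ count-mono {n G} (λ w _ → on-a-everywhere w) ⟩
    count (on a)             ≡⟨ count-on a (all-covered a) ⟩
    2                        ∎
    where open ≤-Reasoning


-- Lower bounds on the number of edges

matching⇒2*size∸1≤numEdges : ∀ G → Connected G → ∀ {M} → IsMatching G M → 1 ≤ size M →
  2 * size M ∸ 1 ≤ numEdges G
matching⇒2*size∸1≤numEdges G conn isM 1≤|M| =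
  ≤-trans (∸-monoˡ-≤ 1 2|M|≤n) (connected⇒n∸1≤numEdges G conn root)
  where
  2|M|≤n = Matching.2*size≤n G isM
  root : Fin (n G)
  root = fromℕ< (≤-trans (*-monoʳ-≤ 2 1≤|M|) 2|M|≤n)

realizes⇒2r∸1≤numEdges : ∀ G p q r → 1 ≤ r → Realizes G p q r → 2 * r ∸ 1 ≤ numEdges G
realizes⇒2r∸1≤numEdges G p q r 1≤r (conn , _ , _ , (M , isM , refl) , _) =
  matching⇒2*size∸1≤numEdges G conn isM 1≤r

realizes⇒2r≤numEdges : ∀ G r → 2 ≤ r → Realizes G r r r → 2 * r ≤ numEdges G
realizes⇒2r≤numEdges G r 2≤r (conn , ((I , isI , |I|≡r) , _) , _ , ((M , isM , |M|≡r) , _)) with 2 * r <? n G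
... | yes 2r<n = ≤-trans (∸-monoˡ-≤ 1 2r<n) (connected⇒n∸1≤numEdges G conn (fromℕ< 2r<n))
... | no  2r≮n = ⊥-elim (<⇒≱ (≤-trans (n≤1+n 3) 4≤n) (perfect-induced⇒n≤2 G conn isI all-covered a))
  where
  2r≤n : 2 * r ≤ n G
  2r≤n = subst (λ s → 2 * s ≤ n G) |M|≡r (Matching.2*size≤n G isM)
  all-covered : ∀ v → covered I v ≡ true
  all-covered = count≡n⇒all (covered I)
    (trans (sym (Matching.2*size≡count-covered G (proj₁ isI)))
           (trans (cong (2 *_) |I|≡r) (≤-antisym 2r≤n (≮⇒≥ 2r≮n))))
  4≤n : 4 ≤ n G
  4≤n = ≤-trans (*-monoʳ-≤ 2 2≤r) 2r≤n
  a : Fin (n G)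
  a = fromℕ< (≤-trans (s≤s z≤n) 4≤n)

2*[1+m]C2≡[1+m]*m : ∀ m → 2 * (suc m C 2) ≡ suc m * m
2*[1+m]C2≡[1+m]*m zero    = refl
2*[1+m]C2≡[1+m]*m (suc m) = begin
  2 * (suc (suc m) C 2)        ≡⟨ cong (2 *_) (sym (nCk+nC[k+1]≡[n+1]C[k+1] (suc m) 1)) ⟩
  2 * (suc m C 1 + suc m C 2)  ≡⟨ cong (λ t → 2 * (t + suc m C 2)) (nC1≡n (suc m)) ⟩
  2 * (suc m + suc m C 2)      ≡⟨ *-distribˡ-+ 2 (suc m) _ ⟩
  2 * suc m + 2 * (suc m C 2)  ≡⟨ cong (2 * suc m +_) (2*[1+m]C2≡[1+m]*m m) ⟩
  2 * suc m + suc m * m        ≡⟨ factor m ⟩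
  suc (suc m) * suc m          ∎
  where
  open ≡-Reasoning
  factor : ∀ m → 2 * suc m + suc m * m ≡ suc (suc m) * suc m
  factor = solve-∀

1≤⟦⟧+⟦⟧+⟦⟧+⟦⟧ : ∀ a b c d → ¬ (a ≡ false × b ≡ false × c ≡ false × d ≡ false) →
  1 ≤ (⟦ a ⟧ + ⟦ b ⟧) + (⟦ c ⟧ + ⟦ d ⟧)
1≤⟦⟧+⟦⟧+⟦⟧+⟦⟧ true  b     c     d     _ = s≤s z≤n
1≤⟦⟧+⟦⟧+⟦⟧+⟦⟧ false true  c     d     _ = s≤s z≤n
1≤⟦⟧+⟦⟧+⟦⟧+⟦⟧ false false true  d     _ = s≤s z≤n
1≤⟦⟧+⟦⟧+⟦⟧+⟦⟧ false false false true  _ = s≤s z≤n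
1≤⟦⟧+⟦⟧+⟦⟧+⟦⟧ false false false false ¬all = ⊥-elim (¬all (refl , refl , refl , refl))

module _ (G : Graph) (ind≤1 : ∀ I → IsInducedMatching G I → size I ≤ 1) {M : EdgeSet G} (isM : IsMatching G M) where
  private
    N = n G
    A = adj G
  open Matching G isM

  -- Two unlinked edges of M would form an induced matching of size 2.
  linked : ∀ v w → covered M v ≡ true → covered M w ≡ true → on v w ≡ false →
           ¬ (∀ x y → on v x ≡ true → on w y ≡ true → A x y ≡ false)
  linked v w cv cw w∉v unlinked = <⇒≱ (subst (1 <_) (sym size≡2) ≤-refl) (ind≤1 matching (induced unlinked))
    where open TwoEdges G isM cv cw w∉v

  link-weight : Fin N → Fin N → ℕ
  link-weight v x = ⟦ A v x ⟧ + ⟦ A (mate M v) x ⟧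

  weight-of-own-edge : ∀ v → covered M v ≡ true → link-weight v v + link-weight v (mate M v) ≡ 2
  weight-of-own-edge v cv
    rewrite irrefl G v | irrefl G (mate M v) | mate-adjacent v cv | Graph.sym G (mate M v) v | mate-adjacent v cv = refl

  weight-of-other-edge : ∀ v w → covered M v ≡ true → covered M w ≡ true → on v w ≡ false →
                         1 ≤ link-weight v w + link-weight v (mate M w)
  weight-of-other-edge v w cv cw w∉v =
    1≤⟦⟧+⟦⟧+⟦⟧+⟦⟧ (A v w) _ _ _
      (λ { (vw , v′w , vw′ , v′w′) → linked v w cv cw w∉v (unlinked vw v′w vw′ v′w′) })
    where
    unlinked : A v w ≡ false → A (mate M v) w ≡ false → A v (mate M w) ≡ false → A (mate M v) (mate M w) ≡ false →
               ∀ x y → on v x ≡ true → on w y ≡ true → A x y ≡ false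
    unlinked vw v′w vw′ v′w′ x y on-vx on-wy with on-elim on-vx | on-elim on-wy
    ... | inj₁ refl | inj₁ refl = vw
    ... | inj₂ refl | inj₁ refl = v′w
    ... | inj₁ refl | inj₂ refl = vw′
    ... | inj₂ refl | inj₂ refl = v′w′

  weight-bound : ∀ v → covered M v ≡ true → ∀ w →
    ⟦ covered M w ⟧ + ⟦ on v w ⟧ ≤ ⟦ covered M w ⟧ * (link-weight v w + link-weight v (mate M w))
  weight-bound v cv w with on v w in on-vw
  ... | false with covered M w in cw
  ...   | false = z≤n
  ...   | true  = subst (1 + 0 ≤_) (sym (+-identityʳ _)) (weight-of-other-edge v w cv cw on-vw)
  weight-bound v cv w | true with on-elim on-vw
  ... | inj₁ refl rewrite cv = ≤-reflexive (sym (trans (+-identityʳ _) (weight-of-own-edge v cv)))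
  ... | inj₂ refl rewrite mate-covered v cv | mate-involutive v cv =
        ≤-reflexive (sym (trans (+-identityʳ _) (trans (+-comm (link-weight v (mate M v)) _) (weight-of-own-edge v cv))))

  -- Each matched edge meets the other size M − 1 matched edges and itself twice.
  mate-degrees : ∀ v → covered M v ≡ true → suc (size M) ≤ degree A v + degree A (mate M v)
  mate-degrees v cv = *-cancelˡ-≤ 2 (begin
    2 * suc (size M)                                    ≡⟨ trans (*-suc 2 (size M)) (+-comm 2 _) ⟩
    2 * size M + 2                                      ≡⟨ cong₂ _+_ 2*size≡count-covered (sym (count-on v cv)) ⟩
    count (covered M) + count (on v)                    ≡⟨ sym (∑-distrib-+ {N} _ _) ⟩
    ∑[ w < N ] (⟦ covered M w ⟧ + ⟦ on v w ⟧)           ≤⟨ ∑-mono-≤ (weight-bound v cv) ⟩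
    ∑[ w < N ] (⟦ covered M w ⟧ * (L w + L (mate M w))) ≤⟨ ∑-matched-pairs≤ L ⟩
    2 * ∑ L                                             ≡⟨ cong (2 *_) (∑-distrib-+ {N} _ _) ⟩
    2 * (degree A v + degree A (mate M v))              ∎)
    where
    open ≤-Reasoning
    L = link-weight v

  [1+size]C2≤numEdges : suc (size M) C 2 ≤ numEdges G
  [1+size]C2≤numEdges = *-cancelˡ-≤ 2 (*-cancelˡ-≤ 2 (begin
    2 * (2 * (suc m C 2))                          ≡⟨ cong (2 *_) (2*[1+m]C2≡[1+m]*m m) ⟩
    2 * (suc m * m)                                ≡⟨ rearrange m ⟩
    suc m * (2 * m)                                ≡⟨ cong (suc m *_) 2*size≡count-covered ⟩
    suc m * count (covered M)                      ≡⟨ sym (∑-*ˡ {N} (suc m) _) ⟩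
    ∑[ v < N ] (suc m * ⟦ covered M v ⟧)           ≤⟨ ∑-mono-≤ bound ⟩
    ∑[ v < N ] (⟦ covered M v ⟧ * (D v + D (mate M v))) ≤⟨ ∑-matched-pairs≤ D ⟩
    2 * ∑ D                                        ≡⟨ cong (2 *_) (sym (handshake A (Graph.sym G) (irrefl G))) ⟩
    2 * (2 * numEdges G)                           ∎))
    where
    open ≤-Reasoning
    m = size M
    D = degree A
    rearrange : ∀ m → 2 * (suc m * m) ≡ suc m * (2 * m)
    rearrange = solve-∀
    bound : ∀ v → suc m * ⟦ covered M v ⟧ ≤ ⟦ covered M v ⟧ * (D v + D (mate M v))
    bound v with covered M v in cv
    ... | false = ≤-reflexive (*-zeroʳ (suc m))
    ... | true  = subst₂ _≤_ (sym (*-identityʳ (suc m))) (sym (+-identityʳ _)) (mate-degrees v cv)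

realizes⇒[1+r]C2≤numEdges : ∀ G q r → Realizes G 1 q r → suc r C 2 ≤ numEdges G
realizes⇒[1+r]C2≤numEdges G q r (_ , (_ , ind≤1) , _ , (M , isM , refl) , _) = [1+size]C2≤numEdges G ind≤1 isM


-- Extremal graphs

module Relabelled (G : Graph) {K : Set} (kind : Fin (n G) → K) (label : K → Fin (n G))
                  (kind∘label : ∀ x → kind (label x) ≡ x) (label∘kind : ∀ u → label (kind u) ≡ u) where

  private
    A = adj G

    A-label : ∀ u v → A u v ≡ A (label (kind u)) (label (kind v))
    A-label u v = sym (cong₂ A (label∘kind u) (label∘kind v))

  record LabelPairing : Set where
    field
      paired             : K → Bool
      partner            : K → K
      partner-paired     : ∀ x → paired x ≡ true → paired (partner x) ≡ true
      partner-involutive : ∀ x → paired x ≡ true → partner (partner x) ≡ x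
      partner-adjacent   : ∀ x → paired x ≡ true → A (label x) (label (partner x)) ≡ true

    pairing : Pairing G
    pairing = record
      { paired             = paired ∘ kind
      ; partner            = label ∘ partner ∘ kind
      ; partner-paired     = λ u pu → subst (λ t → paired t ≡ true) (sym (kind∘label _)) (partner-paired _ pu)
      ; partner-involutive = λ u pu → trans (cong (label ∘ partner) (kind∘label _))
                                            (trans (cong label (partner-involutive _ pu)) (label∘kind u))
      ; partner-adjacent   = λ u pu → subst (λ t → A t (label (partner (kind u))) ≡ true) (label∘kind u)
                                            (partner-adjacent _ pu) }

    open Pairing pairing public using (matching; isMatching; matching-intro; covered≡paired; 2*size≡count-paired)

    induced : (∀ x y → paired x ≡ true → paired y ≡ true → A (label x) (label y) ≡ true → partner x ≡ y) →
              IsInducedMatching G matching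
    induced partners = closed⇒induced G isMatching closed
      where
      closed : ∀ u v → covered matching u ≡ true → covered matching v ≡ true → A u v ≡ true → matching u v ≡ true
      closed u v cu cv Auv =
        subst (λ t → matching u t ≡ true) (trans (cong label partner≡) (label∘kind v)) (matching-intro u pu)
        where
        pu = trans (sym (covered≡paired u)) cu
        partner≡ = partners _ _ pu (trans (sym (covered≡paired v)) cv) (trans (sym (A-label u v)) Auv)

    maximal : (∀ x y → A (label x) (label y) ≡ true → paired x ≡ true ⊎ paired y ≡ true) →
              IsMaximalMatching G matching
    maximal covers = covers⇒maximal G isMatching λ u v Auv →
      Sum.map (trans (covered≡paired u)) (trans (covered≡paired v)) (covers _ _ (trans (sym (A-label u v)) Auv))

module LabelledTree {N : ℕ} {K : Set} (kind : Fin N → K) (label : K → Fin N)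
    (kind∘label : ∀ x → kind (label x) ≡ x) (label∘kind : ∀ u → label (kind u) ≡ u)
    (root : K) (parent : K → K) (rank : K → ℕ) (parent-descends : ∀ x → x ≢ root → rank (parent x) < rank x) where

  private
    kind≢root : ∀ {u} → u ≢ label root → kind u ≢ root
    kind≢root {u} u≢root kind≡root = u≢root (trans (sym (label∘kind u)) (cong label kind≡root))

    label-injective : ∀ {x y} → label x ≡ label y → x ≡ y
    label-injective {x} {y} e = trans (sym (kind∘label x)) (trans (cong kind e) (kind∘label y))

    label≢root : ∀ {x} → x ≢ root → label x ≢ label root
    label≢root x≢root = x≢root ∘ label-injective

  tree : RootedTree N
  tree = record
    { root            = label root
    ; parent          = label ∘ parent ∘ kind
    ; rank            = rank ∘ kind
    ; parent-descends = λ u u≢root → subst (λ t → rank t < rank (kind u)) (sym (kind∘label _))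
                                           (parent-descends (kind u) (kind≢root u≢root)) }

  open RootedTree tree public using (graph; connected; numEdges-tree)
  open Relabelled graph kind label kind∘label label∘kind

  edge-kinds : ∀ x y → adj graph (label x) (label y) ≡ true →
    (x ≢ root × parent x ≡ y) ⊎ (y ≢ root × parent y ≡ x)
  edge-kinds x y e with RootedTree.tree-adj-elim tree e
  ... | inj₁ (x≢root , p≡y) = inj₁ (subst (_≢ root) (kind∘label x) (kind≢root x≢root) ,
                                     trans (cong parent (sym (kind∘label x))) (label-injective p≡y))
  ... | inj₂ (y≢root , p≡x) = inj₂ (subst (_≢ root) (kind∘label y) (kind≢root y≢root) ,
                                     trans (cong parent (sym (kind∘label y))) (label-injective p≡x))

  parent-edge : ∀ x → x ≢ root → adj graph (label x) (label (parent x)) ≡ true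
  parent-edge x x≢root = subst (λ t → adj graph (label x) (label (parent t)) ≡ true) (kind∘label x)
                               (RootedTree.tree-adj-parent tree (label x) (label≢root x≢root))

  record TreePairing : Set where
    field
      paired             : K → Bool
      partner            : K → K
      partner-paired     : ∀ x → paired x ≡ true → paired (partner x) ≡ true
      partner-involutive : ∀ x → paired x ≡ true → partner (partner x) ≡ x
      partner-parent     : ∀ x → paired x ≡ true →
                           (x ≢ root × parent x ≡ partner x) ⊎ (partner x ≢ root × parent (partner x) ≡ x)

    labelPairing : LabelPairing
    labelPairing = record
      { paired = paired ; partner = partner
      ; partner-paired = partner-paired ; partner-involutive = partner-involutive
      ; partner-adjacent = adjacent }
      where
      adjacent : ∀ x → paired x ≡ true → adj graph (label x) (label (partner x)) ≡ true
      adjacent x px with partner-parent x px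
      ... | inj₁ (x≢root , e)  = subst (λ t → adj graph (label x) (label t) ≡ true) e (parent-edge x x≢root)
      ... | inj₂ (x′≢root , e) = trans (Graph.sym graph (label x) _)
                                       (subst (λ t → adj graph _ (label t) ≡ true) e (parent-edge _ x′≢root))

    open LabelPairing labelPairing public using (matching; isMatching; 2*size≡count-paired)

    induced : (∀ x → x ≢ root → paired x ≡ true → paired (parent x) ≡ true → partner x ≡ parent x) →
              IsInducedMatching graph matching
    induced parent-partner = LabelPairing.induced labelPairing partners
      where
      partners : ∀ x y → paired x ≡ true → paired y ≡ true → adj graph (label x) (label y) ≡ true → partner x ≡ y
      partners x y px py Axy with edge-kinds x y Axy
      ... | inj₁ (x≢root , refl) = parent-partner x x≢root px py
      ... | inj₂ (y≢root , refl) = trans (cong partner (sym (parent-partner y y≢root py px))) (partner-involutive y py)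

    maximal : (∀ x → x ≢ root → paired x ≡ true ⊎ paired (parent x) ≡ true) → IsMaximalMatching graph matching
    maximal covers = LabelPairing.maximal labelPairing edge-covered
      where
      edge-covered : ∀ x y → adj graph (label x) (label y) ≡ true → paired x ≡ true ⊎ paired y ≡ true
      edge-covered x y Axy with edge-kinds x y Axy
      ... | inj₁ (x≢root , refl) = covers x x≢root
      ... | inj₂ (y≢root , refl) = swap (covers y y≢root)

data SpiderVertex (r : ℕ) : Set where
  centre     : SpiderVertex r
  knee foot  : Fin r → SpiderVertex r

module Spider (r : ℕ) where
  kind : Fin (suc (r + r)) → SpiderVertex r
  kind fz     = centre
  kind (fs u) = [ knee , foot ]′ (splitAt r u)

  label : SpiderVertex r → Fin (suc (r + r))
  label centre   = fz
  label (knee k) = fs (k ↑ˡ r)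
  label (foot k) = fs (r ↑ʳ k)

  kind∘label : ∀ x → kind (label x) ≡ x
  kind∘label centre   = refl
  kind∘label (knee k) rewrite Fin.splitAt-↑ˡ r k r = refl
  kind∘label (foot k) rewrite Fin.splitAt-↑ʳ r r k = refl

  label∘kind : ∀ u → label (kind u) ≡ u
  label∘kind fz = refl
  label∘kind (fs u) with splitAt r u in e
  ... | inj₁ k = cong fs (Fin.splitAt⁻¹-↑ˡ e)
  ... | inj₂ k = cong fs (Fin.splitAt⁻¹-↑ʳ e)

  parent : SpiderVertex r → SpiderVertex r
  parent centre   = centre
  parent (knee k) = centre
  parent (foot k) = knee k

  depth : SpiderVertex r → ℕ
  depth centre   = 0
  depth (knee _) = 1
  depth (foot _) = 2

  parent-descends : ∀ x → x ≢ centre → depth (parent x) < depth x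
  parent-descends centre   x≢c = ⊥-elim (x≢c refl)
  parent-descends (knee k) _   = s≤s z≤n
  parent-descends (foot k) _   = s≤s (s≤s z≤n)

  open LabelledTree kind label kind∘label label∘kind centre parent depth parent-descends public

  legs : TreePairing
  legs = record
    { paired = on-leg ; partner = other-end
    ; partner-paired = λ { (knee k) _ → refl ; (foot k) _ → refl }
    ; partner-involutive = λ { (knee k) _ → refl ; (foot k) _ → refl }
    ; partner-parent = λ { (knee k) _ → inj₂ ((λ ()) , refl) ; (foot k) _ → inj₁ ((λ ()) , refl) } }
    where
    on-leg : SpiderVertex r → Bool
    on-leg centre = false
    on-leg _      = true
    other-end : SpiderVertex r → SpiderVertex r
    other-end centre   = centre
    other-end (knee k) = foot k
    other-end (foot k) = knee k
  open TreePairing legs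

  size≡r : size matching ≡ r
  size≡r = *-cancelˡ-≡ _ _ 2 (begin
    2 * size matching                         ≡⟨ 2*size≡count-paired ⟩
    ∑[ u < r + r ] ⟦ paired (kind (fs u)) ⟧   ≡⟨ ∑-splitAt r r (λ x → ⟦ paired ([ knee , foot ]′ x) ⟧) ⟩
    ∑[ k < r ] 1 + ∑[ k < r ] 1               ≡⟨ cong₂ _+_ (∑-1 r) (∑-1 r) ⟩
    r + r                                     ≡⟨ cong (r +_) (sym (+-identityʳ r)) ⟩
    2 * r                                     ∎)
    where open ≡-Reasoning

  realizes : Realizes graph r r r
  realizes = connected , proj₁ ind×min , proj₂ ind×min
           , near-perfect⇒MatchNum graph r isMatching size≡r (≤-reflexive (cong suc (cong (r +_) (sym (+-identityʳ r)))))
    where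
    ind×min = induced-and-maximal⇒ind≡min graph r
      (induced λ { (knee k) _ _ () ; (foot k) _ _ _ → refl ; centre c≢c → ⊥-elim (c≢c refl) }) size≡r
      (maximal λ { centre c≢c → ⊥-elim (c≢c refl) ; (knee k) _ → inj₁ refl ; (foot k) _ → inj₁ refl }) size≡r

  numEdges≡2r : numEdges graph ≡ 2 * r
  numEdges≡2r = trans numEdges-tree (cong (r +_) (sym (+-identityʳ r)))

data CaterpillarVertex (s t : ℕ) : Set where
  spine arm spine-leaf arm-leaf : Fin s → CaterpillarVertex s t
  stem stem-leaf            : Fin t → CaterpillarVertex s t

-- The spine vertices form a star around spine 0; each carries a leaf and a two-edge arm, and t pendant edges hang off spine 0.
module Caterpillar (s′ t : ℕ) where
  s = suc s′
  N = (s + s) + ((s + s) + (t + t))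
  V = CaterpillarVertex s t

  kind-back : Fin ((s + s) + (t + t)) → V
  kind-back = [ [ spine-leaf , arm-leaf ]′ ∘ splitAt s , [ stem , stem-leaf ]′ ∘ splitAt t ]′ ∘ splitAt (s + s)

  kind : Fin N → V
  kind = [ [ spine , arm ]′ ∘ splitAt s , kind-back ]′ ∘ splitAt (s + s)

  label : V → Fin N
  label (spine l)      = (l ↑ˡ s) ↑ˡ ((s + s) + (t + t))
  label (arm l)        = (s ↑ʳ l) ↑ˡ ((s + s) + (t + t))
  label (spine-leaf l) = (s + s) ↑ʳ ((l ↑ˡ s) ↑ˡ (t + t))
  label (arm-leaf l)   = (s + s) ↑ʳ ((s ↑ʳ l) ↑ˡ (t + t))
  label (stem l)       = (s + s) ↑ʳ ((s + s) ↑ʳ (l ↑ˡ t))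
  label (stem-leaf l)  = (s + s) ↑ʳ ((s + s) ↑ʳ (t ↑ʳ l))

  kind∘label : ∀ x → kind (label x) ≡ x
  kind∘label (spine l)
    rewrite Fin.splitAt-↑ˡ (s + s) (l ↑ˡ s) ((s + s) + (t + t)) | Fin.splitAt-↑ˡ s l s = refl
  kind∘label (arm l)
    rewrite Fin.splitAt-↑ˡ (s + s) (s ↑ʳ l) ((s + s) + (t + t)) | Fin.splitAt-↑ʳ s s l = refl
  kind∘label (spine-leaf l)
    rewrite Fin.splitAt-↑ʳ (s + s) ((s + s) + (t + t)) ((l ↑ˡ s) ↑ˡ (t + t))
          | Fin.splitAt-↑ˡ (s + s) (l ↑ˡ s) (t + t) | Fin.splitAt-↑ˡ s l s = refl
  kind∘label (arm-leaf l)
    rewrite Fin.splitAt-↑ʳ (s + s) ((s + s) + (t + t)) ((s ↑ʳ l) ↑ˡ (t + t))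
          | Fin.splitAt-↑ˡ (s + s) (s ↑ʳ l) (t + t) | Fin.splitAt-↑ʳ s s l = refl
  kind∘label (stem l)
    rewrite Fin.splitAt-↑ʳ (s + s) ((s + s) + (t + t)) ((s + s) ↑ʳ (l ↑ˡ t))
          | Fin.splitAt-↑ʳ (s + s) (t + t) (l ↑ˡ t) | Fin.splitAt-↑ˡ t l t = refl
  kind∘label (stem-leaf l)
    rewrite Fin.splitAt-↑ʳ (s + s) ((s + s) + (t + t)) ((s + s) ↑ʳ (t ↑ʳ l))
          | Fin.splitAt-↑ʳ (s + s) (t + t) (t ↑ʳ l) | Fin.splitAt-↑ʳ t t l = refl

  label∘kind : ∀ u → label (kind u) ≡ u
  label∘kind u with splitAt (s + s) u in e₁
  ... | inj₁ a with splitAt s a in e₂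
  ...   | inj₁ l = trans (cong (_↑ˡ _) (Fin.splitAt⁻¹-↑ˡ e₂)) (Fin.splitAt⁻¹-↑ˡ e₁)
  ...   | inj₂ l = trans (cong (_↑ˡ _) (Fin.splitAt⁻¹-↑ʳ e₂)) (Fin.splitAt⁻¹-↑ˡ e₁)
  label∘kind u | inj₂ b with splitAt (s + s) b in e₂
  ... | inj₁ c with splitAt s c in e₃
  ...   | inj₁ l = trans (cong ((s + s) ↑ʳ_) (trans (cong (_↑ˡ _) (Fin.splitAt⁻¹-↑ˡ e₃)) (Fin.splitAt⁻¹-↑ˡ e₂))) (Fin.splitAt⁻¹-↑ʳ e₁)
  ...   | inj₂ l = trans (cong ((s + s) ↑ʳ_) (trans (cong (_↑ˡ _) (Fin.splitAt⁻¹-↑ʳ e₃)) (Fin.splitAt⁻¹-↑ˡ e₂))) (Fin.splitAt⁻¹-↑ʳ e₁)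
  label∘kind u | inj₂ b | inj₂ d with splitAt t d in e₃
  ... | inj₁ l = trans (cong ((s + s) ↑ʳ_) (trans (cong ((s + s) ↑ʳ_) (Fin.splitAt⁻¹-↑ˡ e₃)) (Fin.splitAt⁻¹-↑ʳ e₂))) (Fin.splitAt⁻¹-↑ʳ e₁)
  ... | inj₂ l = trans (cong ((s + s) ↑ʳ_) (trans (cong ((s + s) ↑ʳ_) (Fin.splitAt⁻¹-↑ʳ e₃)) (Fin.splitAt⁻¹-↑ʳ e₂))) (Fin.splitAt⁻¹-↑ʳ e₁)

  ∑-kinds : ∀ (F : V → ℕ) → ∑[ u < N ] F (kind u) ≡
    (∑ (F ∘ spine) + ∑ (F ∘ arm)) + ((∑ (F ∘ spine-leaf) + ∑ (F ∘ arm-leaf)) + (∑ (F ∘ stem) + ∑ (F ∘ stem-leaf)))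
  ∑-kinds F = trans (∑-splitAt (s + s) ((s + s) + (t + t)) (F ∘ [ [ spine , arm ]′ ∘ splitAt s , kind-back ]′))
    (cong₂ _+_ (∑-splitAt s s (F ∘ [ spine , arm ]′))
               (trans (∑-splitAt (s + s) (t + t) (F ∘ [ [ spine-leaf , arm-leaf ]′ ∘ splitAt s , [ stem , stem-leaf ]′ ∘ splitAt t ]′))
                      (cong₂ _+_ (∑-splitAt s s (F ∘ [ spine-leaf , arm-leaf ]′)) (∑-splitAt t t (F ∘ [ stem , stem-leaf ]′)))))

  root : V
  root = spine fz

  parent : V → V
  parent (spine l)      = root
  parent (arm l)        = spine l
  parent (spine-leaf l) = spine l
  parent (arm-leaf l)   = arm l
  parent (stem l)       = root
  parent (stem-leaf l)  = stem l

  depth : V → ℕ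
  depth (spine fz)     = 0
  depth (spine (fs _)) = 1
  depth (arm _)        = 2
  depth (spine-leaf _) = 2
  depth (arm-leaf _)   = 3
  depth (stem _)       = 1
  depth (stem-leaf _)  = 2

  depth-spine≤1 : ∀ l → depth (spine l) ≤ 1
  depth-spine≤1 fz     = z≤n
  depth-spine≤1 (fs _) = ≤-refl

  parent-descends : ∀ x → x ≢ root → depth (parent x) < depth x
  parent-descends (spine fz)     x≢root = ⊥-elim (x≢root refl)
  parent-descends (spine (fs l)) _      = s≤s z≤n
  parent-descends (arm l)        _      = s≤s (depth-spine≤1 l)
  parent-descends (spine-leaf l) _      = s≤s (depth-spine≤1 l)
  parent-descends (arm-leaf l)   _      = ≤-refl
  parent-descends (stem l)       _      = s≤s z≤n
  parent-descends (stem-leaf l)  _      = ≤-refl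

  open LabelledTree kind label kind∘label label∘kind root parent depth parent-descends public

  q = s + t
  r = s + q

  spine-arm : TreePairing
  spine-arm = record
    { paired = paired ; partner = partner
    ; partner-paired     = λ { (spine l) _ → refl ; (arm l) _ → refl ; (stem l) _ → refl ; (stem-leaf l) _ → refl }
    ; partner-involutive = λ { (spine l) _ → refl ; (arm l) _ → refl ; (stem l) _ → refl ; (stem-leaf l) _ → refl }
    ; partner-parent     = λ { (spine l) _ → inj₂ ((λ ()) , refl) ; (arm l) _ → inj₁ ((λ ()) , refl)
                         ; (stem l) _ → inj₂ ((λ ()) , refl) ; (stem-leaf l) _ → inj₁ ((λ ()) , refl) } }
    where
    paired : V → Bool
    paired (spine-leaf _) = false
    paired (arm-leaf _)   = false
    paired _              = true
    partner : V → V
    partner (spine l)     = arm l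
    partner (arm l)       = spine l
    partner (stem l)      = stem-leaf l
    partner (stem-leaf l) = stem l
    partner x             = x

  arm-leaf-matching : TreePairing
  arm-leaf-matching = record
    { paired = paired ; partner = partner
    ; partner-paired     = λ { (arm l) _ → refl ; (arm-leaf l) _ → refl ; (stem l) _ → refl ; (stem-leaf l) _ → refl }
    ; partner-involutive = λ { (arm l) _ → refl ; (arm-leaf l) _ → refl ; (stem l) _ → refl ; (stem-leaf l) _ → refl }
    ; partner-parent     = λ { (arm l) _ → inj₂ ((λ ()) , refl) ; (arm-leaf l) _ → inj₁ ((λ ()) , refl)
                         ; (stem l) _ → inj₂ ((λ ()) , refl) ; (stem-leaf l) _ → inj₁ ((λ ()) , refl) } }
    where
    paired : V → Bool
    paired (spine _)      = false
    paired (spine-leaf _) = false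
    paired _              = true
    partner : V → V
    partner (arm l)       = arm-leaf l
    partner (arm-leaf l)  = arm l
    partner (stem l)      = stem-leaf l
    partner (stem-leaf l) = stem l
    partner x             = x

  perfect : TreePairing
  perfect = record
    { paired = λ _ → true ; partner = partner
    ; partner-paired     = λ _ _ → refl
    ; partner-involutive = λ { (spine l) _ → refl ; (arm l) _ → refl ; (spine-leaf l) _ → refl
                             ; (arm-leaf l) _ → refl ; (stem l) _ → refl ; (stem-leaf l) _ → refl }
    ; partner-parent = λ { (spine l) _ → inj₂ ((λ ()) , refl) ; (spine-leaf l) _ → inj₁ ((λ ()) , refl)
                         ; (arm l) _ → inj₂ ((λ ()) , refl) ; (arm-leaf l) _ → inj₁ ((λ ()) , refl)
                         ; (stem l) _ → inj₂ ((λ ()) , refl) ; (stem-leaf l) _ → inj₁ ((λ ()) , refl) } }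
    where
    partner : V → V
    partner (spine l)      = spine-leaf l
    partner (spine-leaf l) = spine l
    partner (arm l)        = arm-leaf l
    partner (arm-leaf l)   = arm l
    partner (stem l)       = stem-leaf l
    partner (stem-leaf l)  = stem l

  module X = TreePairing spine-arm
  module I = TreePairing arm-leaf-matching
  module P = TreePairing perfect

  N≡2r : N ≡ 2 * r
  N≡2r = arith s t
    where
    arith : ∀ s t → (s + s) + ((s + s) + (t + t)) ≡ 2 * (s + (s + t))
    arith = solve-∀

  size-X≡q : size X.matching ≡ q
  size-X≡q = *-cancelˡ-≡ _ _ 2 (trans X.2*size≡count-paired (trans (∑-kinds (λ x → ⟦ X.paired x ⟧))
    (trans (cong₂ _+_ (cong₂ _+_ (∑-1 s) (∑-1 s)) (cong₂ _+_ (cong₂ _+_ (∑0 s) (∑0 s)) (cong₂ _+_ (∑-1 t) (∑-1 t))))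
           (arith s t))))
    where
    arith : ∀ s t → (s + s) + ((0 + 0) + (t + t)) ≡ 2 * (s + t)
    arith = solve-∀

  size-I≡q : size I.matching ≡ q
  size-I≡q = *-cancelˡ-≡ _ _ 2 (trans I.2*size≡count-paired (trans (∑-kinds (λ x → ⟦ I.paired x ⟧))
    (trans (cong₂ _+_ (cong₂ _+_ (∑0 s) (∑-1 s)) (cong₂ _+_ (cong₂ _+_ (∑0 s) (∑-1 s)) (cong₂ _+_ (∑-1 t) (∑-1 t))))
           (arith s t))))
    where
    arith : ∀ s t → (0 + s) + ((0 + s) + (t + t)) ≡ 2 * (s + t)
    arith = solve-∀

  size-P≡r : size P.matching ≡ r
  size-P≡r = *-cancelˡ-≡ _ _ 2 (trans P.2*size≡count-paired (trans (∑-1 N) N≡2r))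

  realizes : Realizes graph q q r
  realizes = connected , proj₁ ind×min , proj₂ ind×min
           , near-perfect⇒MatchNum graph r P.isMatching size-P≡r (≤-trans (≤-reflexive N≡2r) (n≤1+n _))
    where
    ind×min = induced-and-maximal⇒ind≡min graph q
      (I.induced λ { (arm l) _ _ () ; (arm-leaf l) _ _ _ → refl ; (stem l) _ _ () ; (stem-leaf l) _ _ _ → refl
                   ; (spine l) _ () _ ; (spine-leaf l) _ () _ }) size-I≡q
      (X.maximal λ { (spine l) _ → inj₁ refl ; (arm l) _ → inj₁ refl ; (spine-leaf l) _ → inj₂ refl
                   ; (arm-leaf l) _ → inj₂ refl ; (stem l) _ → inj₁ refl ; (stem-leaf l) _ → inj₁ refl }) size-X≡q

  numEdges≡2r∸1 : numEdges graph ≡ 2 * r ∸ 1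
  numEdges≡2r∸1 = trans numEdges-tree (cong (_∸ 1) N≡2r)

data Hub (k d : ℕ) : Set where
  left right : Fin k → Hub k d
  middle     : Fin d → Hub k d

-- K_m (m = 2k + d) with a pendant leaf at every vertex: inj₁ i is the clique vertex (hub) i, inj₂ i its leaf.
module PendantClique (k d : ℕ) where
  m = (k + d) + k
  V = Fin m ⊎ Fin m

  adjV : V → V → Bool
  adjV (inj₁ i) (inj₁ j) = not (i == j)
  adjV (inj₁ i) (inj₂ j) = i == j
  adjV (inj₂ i) (inj₁ j) = i == j
  adjV (inj₂ _) (inj₂ _) = false

  graph : Graph
  graph = record
    { n = m + m
    ; adj = λ u v → adjV (splitAt m u) (splitAt m v)
    ; sym = λ u v → adjV-sym (splitAt m u) (splitAt m v)
    ; irrefl = λ u → adjV-irrefl (splitAt m u) }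
    where
    adjV-sym : ∀ x y → adjV x y ≡ adjV y x
    adjV-sym (inj₁ i) (inj₁ j) = cong not (==-sym i j)
    adjV-sym (inj₁ i) (inj₂ j) = ==-sym i j
    adjV-sym (inj₂ i) (inj₁ j) = ==-sym i j
    adjV-sym (inj₂ i) (inj₂ j) = refl
    adjV-irrefl : ∀ x → adjV x x ≡ false
    adjV-irrefl (inj₁ i) rewrite ==-refl i = refl
    adjV-irrefl (inj₂ i) = refl

  label : V → Fin (m + m)
  label = join m m

  adj-label : ∀ x y → adj graph (label x) (label y) ≡ adjV x y
  adj-label x y rewrite Fin.splitAt-join m m x | Fin.splitAt-join m m y = refl

  is-hub : V → Bool
  is-hub (inj₁ _) = true
  is-hub (inj₂ _) = false

  ∑-V : ∀ (F : V → ℕ) → ∑[ u < m + m ] F (splitAt m u) ≡ ∑ (F ∘ inj₁) + ∑ (F ∘ inj₂)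
  ∑-V = ∑-splitAt m m

  numEdges≡[1+m]C2 : numEdges graph ≡ suc m C 2
  numEdges≡[1+m]C2 = *-cancelˡ-≡ _ _ 2 (begin
    2 * numEdges graph                                ≡⟨ handshake (adj graph) (Graph.sym graph) (irrefl graph) ⟩
    ∑[ u < m + m ] degree (adj graph) u               ≡⟨ sum-cong-≗ {m + m} (λ u → degree-V (splitAt m u)) ⟩
    ∑[ u < m + m ] (if is-hub (splitAt m u) then m else 1) ≡⟨ ∑-V (λ x → if is-hub x then m else 1) ⟩
    ∑[ i < m ] m + ∑[ i < m ] 1                       ≡⟨ cong₂ _+_ (∑-const m m) (∑-1 m) ⟩
    m * m + m                                         ≡⟨ +-comm (m * m) m ⟩
    suc m * m                                         ≡⟨ sym (2*[1+m]C2≡[1+m]*m m) ⟩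
    2 * (suc m C 2)                                   ∎)
    where
    open ≡-Reasoning
    degree-V : ∀ x → ∑[ v < m + m ] ⟦ adjV x (splitAt m v) ⟧ ≡ (if is-hub x then m else 1)
    degree-V (inj₁ i) = trans (∑-V (λ y → ⟦ adjV (inj₁ i) y ⟧)) (trans (sym (∑-distrib-+ {m} _ _))
                              (trans (sum-cong-≗ {m} one) (∑-1 m)))
      where
      one : ∀ j → ⟦ not (i == j) ⟧ + ⟦ i == j ⟧ ≡ 1
      one j with i == j
      ... | true  = refl
      ... | false = refl
    degree-V (inj₂ i) = trans (∑-V (λ y → ⟦ adjV (inj₂ i) y ⟧)) (cong₂ _+_ (count-singleton i) (∑0 m))

  module _ (a₀ : Fin m) where
    connected : Connected graph
    connected = descent⇒connected graph (label (inj₁ a₀)) (label ∘ parent ∘ splitAt m) (rank ∘ splitAt m) descent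
      where
      parent : V → V
      parent (inj₁ i) = inj₁ a₀
      parent (inj₂ i) = inj₁ i
      rank : V → ℕ
      rank (inj₁ i) = if i == a₀ then 0 else 1
      rank (inj₂ i) = 2
      rank-hub<2 : ∀ i → rank (inj₁ i) < 2
      rank-hub<2 i with i == a₀
      ... | true  = s≤s z≤n
      ... | false = s≤s (s≤s z≤n)
      descentV : ∀ x → x ≡ inj₁ a₀ ⊎ (adjV x (parent x) ≡ true × rank (parent x) < rank x)
      descentV (inj₁ i) with i Fin.≟ a₀
      ... | yes refl = inj₁ refl
      ... | no _ rewrite ==-refl a₀ = inj₂ (refl , s≤s z≤n)
      descentV (inj₂ i) rewrite ==-refl i = inj₂ (refl , rank-hub<2 i)
      descent : ∀ u → u ≡ label (inj₁ a₀) ⊎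
        (adj graph u (label (parent (splitAt m u))) ≡ true × rank (splitAt m (label (parent (splitAt m u)))) < rank (splitAt m u))
      descent u rewrite Fin.splitAt-join m m (parent (splitAt m u)) with descentV (splitAt m u)
      ... | inj₁ e    = inj₁ (trans (sym (Fin.join-splitAt m m u)) (cong label e))
      ... | inj₂ step = inj₂ step

  open Relabelled graph (splitAt m) label (Fin.splitAt-join m m) (Fin.join-splitAt m m)

  rung-pairing : (paired : V → Bool) → (∀ x → paired (swap x) ≡ paired x) → LabelPairing
  rung-pairing paired swap-invariant = record
    { paired = paired ; partner = swap
    ; partner-paired = λ x px → trans (swap-invariant x) px
    ; partner-involutive = λ x _ → swap-involutive x
    ; partner-adjacent = λ { (inj₁ i) _ → trans (adj-label (inj₁ i) (inj₂ i)) (==-refl i)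
                           ; (inj₂ i) _ → trans (adj-label (inj₂ i) (inj₁ i)) (==-refl i) } }

  perfect : LabelPairing
  perfect = rung-pairing (λ _ → true) (λ _ → refl)

  module Perfect = LabelPairing perfect

  matchNum : MatchNum graph m
  matchNum = near-perfect⇒MatchNum graph m Perfect.isMatching size≡m (≤-trans (≤-reflexive m+m≡2m) (n≤1+n _))
    where
    m+m≡2m = cong (m +_) (sym (+-identityʳ m))
    size≡m = *-cancelˡ-≡ _ _ 2 (trans Perfect.2*size≡count-paired (trans (∑-1 (m + m)) m+m≡2m))

  ind-match≤1 : ∀ I → IsInducedMatching graph I → size I ≤ 1
  ind-match≤1 I = hub-cover⇒induced≤1 graph (is-hub ∘ splitAt m) edge-meets-hub hubs-adjacent
    where
    edge-meets-hub : ∀ u v → adj graph u v ≡ true → is-hub (splitAt m u) ≡ true ⊎ is-hub (splitAt m v) ≡ true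
    edge-meets-hub u v Auv with splitAt m u | splitAt m v
    ... | inj₁ _ | _      = inj₁ refl
    ... | inj₂ _ | inj₁ _ = inj₂ refl
    hubs-adjacent : ∀ u v → is-hub (splitAt m u) ≡ true → is-hub (splitAt m v) ≡ true → u ≢ v →
                    adj graph u v ≡ true
    hubs-adjacent u v hu hv u≢v with splitAt m u in eu | splitAt m v in ev
    ... | inj₁ i | inj₁ j = cong not (==-≢ λ i≡j →
            u≢v (trans (sym (Fin.splitAt⁻¹-↑ˡ eu)) (trans (cong (_↑ˡ m) i≡j) (Fin.splitAt⁻¹-↑ˡ ev))))

  module _ (a₀ : Fin m) where
    at-a₀ : V → Bool
    at-a₀ (inj₁ i) = i == a₀
    at-a₀ (inj₂ i) = i == a₀

    at-a₀-swap : ∀ x → at-a₀ (swap x) ≡ at-a₀ x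
    at-a₀-swap (inj₁ i) = refl
    at-a₀-swap (inj₂ i) = refl

    module Rung = LabelPairing (rung-pairing at-a₀ at-a₀-swap)

    indMatchNum : IndMatchNum graph 1
    indMatchNum = (Rung.matching , Rung.induced partners , size≡1) , ind-match≤1
      where
      partners : ∀ x y → Rung.paired x ≡ true → Rung.paired y ≡ true →
                 adj graph (label x) (label y) ≡ true → swap x ≡ y
      partners x y px py Axy = rung x y px py (trans (sym (adj-label x y)) Axy)
        where
        same : ∀ {i j} → (i == a₀) ≡ true → (j == a₀) ≡ true → i ≡ j
        same p q = trans (==⇒≡ p) (sym (==⇒≡ q))
        rung : ∀ x y → at-a₀ x ≡ true → at-a₀ y ≡ true → adjV x y ≡ true → swap x ≡ y
        rung (inj₁ i) (inj₁ j) p q Axy′ with refl ← same {i} {j} p q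
                                        with () ← trans (sym Axy′) (cong not (==-refl i))
        rung (inj₁ i) (inj₂ j) p q _ = cong inj₂ (same p q)
        rung (inj₂ i) (inj₁ j) p q _ = cong inj₁ (same p q)
      size≡1 : size Rung.matching ≡ 1
      size≡1 = *-cancelˡ-≡ _ _ 2 (trans Rung.2*size≡count-paired (trans (∑-V (λ x → ⟦ Rung.paired x ⟧))
                 (cong₂ _+_ (trans (sum-cong-≗ {m} (λ i → cong ⟦_⟧ (==-sym i a₀))) (count-singleton a₀))
                            (trans (sum-cong-≗ {m} (λ i → cong ⟦_⟧ (==-sym i a₀))) (count-singleton a₀)))))

  hub-kind : Fin m → Hub k d
  hub-kind = [ [ left , middle ]′ ∘ splitAt k , right ]′ ∘ splitAt (k + d)

  hub-label : Hub k d → Fin m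
  hub-label (left l)   = (l ↑ˡ d) ↑ˡ k
  hub-label (middle l) = (k ↑ʳ l) ↑ˡ k
  hub-label (right l)  = (k + d) ↑ʳ l

  hub-kind∘hub-label : ∀ h → hub-kind (hub-label h) ≡ h
  hub-kind∘hub-label (left l)   rewrite Fin.splitAt-↑ˡ (k + d) (l ↑ˡ d) k | Fin.splitAt-↑ˡ k l d = refl
  hub-kind∘hub-label (middle l) rewrite Fin.splitAt-↑ˡ (k + d) (k ↑ʳ l) k | Fin.splitAt-↑ʳ k d l = refl
  hub-kind∘hub-label (right l)  rewrite Fin.splitAt-↑ʳ (k + d) k l = refl

  hub-label∘hub-kind : ∀ i → hub-label (hub-kind i) ≡ i
  hub-label∘hub-kind i with splitAt (k + d) i in e₁
  ... | inj₂ l = Fin.splitAt⁻¹-↑ʳ e₁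
  ... | inj₁ j with splitAt k j in e₂
  ...   | inj₁ l = trans (cong (_↑ˡ k) (Fin.splitAt⁻¹-↑ˡ e₂)) (Fin.splitAt⁻¹-↑ˡ e₁)
  ...   | inj₂ l = trans (cong (_↑ˡ k) (Fin.splitAt⁻¹-↑ʳ e₂)) (Fin.splitAt⁻¹-↑ˡ e₁)

  is-middle : Hub k d → Bool
  is-middle (middle _) = true
  is-middle _          = false

  hub-partner : Fin m → Hub k d → V
  hub-partner i (left l)   = inj₁ (hub-label (right l))
  hub-partner i (right l)  = inj₁ (hub-label (left l))
  hub-partner i (middle _) = inj₂ i

  -- Left hubs are matched to right hubs and the (at most one) middle hub to its leaf.
  hub-pairing : LabelPairing
  hub-pairing = record
    { paired = paired ; partner = partner
    ; partner-paired = partner-paired ; partner-involutive = partner-involutive ; partner-adjacent = partner-adjacent }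
    where
    paired : V → Bool
    paired (inj₁ _) = true
    paired (inj₂ i) = is-middle (hub-kind i)

    partner : V → V
    partner (inj₁ i) = hub-partner i (hub-kind i)
    partner (inj₂ i) = inj₁ i

    partner-paired : ∀ x → paired x ≡ true → paired (partner x) ≡ true
    partner-paired (inj₁ i) _ with hub-kind i in e
    ... | left _   = refl
    ... | right _  = refl
    ... | middle _ rewrite e = refl
    partner-paired (inj₂ i) _ = refl

    partner-involutive : ∀ x → paired x ≡ true → partner (partner x) ≡ x
    partner-involutive (inj₁ i) _ with hub-kind i in e
    ... | left l   rewrite hub-kind∘hub-label (right l) = cong inj₁ (trans (cong hub-label (sym e)) (hub-label∘hub-kind i))
    ... | right l  rewrite hub-kind∘hub-label (left l)  = cong inj₁ (trans (cong hub-label (sym e)) (hub-label∘hub-kind i))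
    ... | middle _ = refl
    partner-involutive (inj₂ i) pi with hub-kind i in e
    ... | middle _ = refl

    other-hub : ∀ i {h h′} → hub-kind i ≡ h → h ≢ h′ → (i == hub-label h′) ≡ false
    other-hub i {h′ = h′} e h≢h′ =
      ==-≢ {i = i} {hub-label h′} λ { refl → h≢h′ (trans (sym e) (hub-kind∘hub-label h′)) }

    partner-adjacent : ∀ x → paired x ≡ true → adj graph (label x) (label (partner x)) ≡ true
    partner-adjacent x px = trans (adj-label x (partner x)) (adjacentV x px)
      where
      adjacentV : ∀ x → paired x ≡ true → adjV x (partner x) ≡ true
      adjacentV (inj₁ i) _ with hub-kind i in e
      ... | left l   rewrite other-hub i {h′ = right l} e (λ ()) = refl
      ... | right l  rewrite other-hub i {h′ = left l} e (λ ()) = refl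
      ... | middle _ = ==-refl i
      adjacentV (inj₂ i) _ = ==-refl i

  module Hubs = LabelPairing hub-pairing

  size-hub-pairing : size Hubs.matching ≡ k + d
  size-hub-pairing = *-cancelˡ-≡ _ _ 2 (begin
    2 * size Hubs.matching                                ≡⟨ Hubs.2*size≡count-paired ⟩
    ∑[ u < m + m ] ⟦ Hubs.paired (splitAt m u) ⟧          ≡⟨ ∑-V (λ x → ⟦ Hubs.paired x ⟧) ⟩
    ∑[ i < m ] 1 + ∑[ i < m ] ⟦ is-middle (hub-kind i) ⟧  ≡⟨ cong₂ _+_ (∑-1 m) count-middle ⟩
    m + d                                                 ≡⟨ arith k d ⟩
    2 * (k + d)                                           ∎)
    where
    open ≡-Reasoning
    count-middle : ∑[ i < m ] ⟦ is-middle (hub-kind i) ⟧ ≡ d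
    count-middle = begin
      ∑[ i < m ] ⟦ is-middle (hub-kind i) ⟧
        ≡⟨ ∑-splitAt (k + d) k (λ z → ⟦ is-middle ([ [ left , middle ]′ ∘ splitAt k , right ]′ z) ⟧) ⟩
      ∑[ j < k + d ] ⟦ is-middle ([ left , middle ]′ (splitAt k j)) ⟧ + ∑[ l < k ] 0
        ≡⟨ cong₂ _+_ (∑-splitAt k d (λ z → ⟦ is-middle ([ left , middle ]′ z) ⟧)) (∑0 k) ⟩
      (∑[ l < k ] 0 + ∑[ l < d ] 1) + 0
        ≡⟨ cong (_+ 0) (cong₂ _+_ (∑0 k) (∑-1 d)) ⟩
      d + 0
        ≡⟨ +-identityʳ d ⟩
      d ∎
    arith : ∀ k d → (k + d) + k + d ≡ 2 * (k + d)
    arith = solve-∀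

  hub-pairing-maximal : IsMaximalMatching graph Hubs.matching
  hub-pairing-maximal = Hubs.maximal λ x y Axy → edge-meets-hub x y (trans (sym (adj-label x y)) Axy)
    where
    edge-meets-hub : ∀ x y → adjV x y ≡ true → Hubs.paired x ≡ true ⊎ Hubs.paired y ≡ true
    edge-meets-hub (inj₁ _) _ _ = inj₁ refl
    edge-meets-hub (inj₂ _) (inj₁ _) _ = inj₂ refl

  hubs-covered : ∀ {M} → IsMaximalMatching graph M → ∀ i → covered M (label (inj₁ i)) ≡ true
  hubs-covered maxM i = pendant⇒covered graph maxM (trans (adj-label (inj₁ i) (inj₂ i)) (==-refl i)) leaf-neighbour
    where
    leaf-neighbour : ∀ u → adj graph (label (inj₂ i)) u ≡ true → u ≡ label (inj₁ i)
    leaf-neighbour u Au rewrite Fin.splitAt-join m m (inj₂ i) with splitAt m u in e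
    ... | inj₁ j = trans (sym (Fin.splitAt⁻¹-↑ˡ e)) (cong (_↑ˡ m) (sym (==⇒≡ Au)))

  half-ceiling : ∀ s → d ≤ 1 → (k + d) + k ≤ 2 * s → k + d ≤ s
  half-ceiling s z≤n       m≤2s = *-cancelˡ-≤ 2 (subst (_≤ 2 * s) (arith k) m≤2s)
    where
    arith : ∀ k → (k + 0) + k ≡ 2 * (k + 0)
    arith = solve-∀
  half-ceiling s (s≤s z≤n) m≤2s = subst (_≤ s) (+-comm 1 k) (*-cancelˡ-< 2 k s (subst (_≤ 2 * s) (arith k) m≤2s))
    where
    arith : ∀ k → (k + 1) + k ≡ suc (2 * k)
    arith = solve-∀

  minMatchNum : d ≤ 1 → MinMatchNum graph (k + d)
  minMatchNum d≤1 = (Hubs.matching , hub-pairing-maximal , size-hub-pairing) , λ M maxM →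
    half-ceiling (size M) d≤1 (begin
      m
        ≡⟨ sym (trans (∑-V (λ x → ⟦ is-hub x ⟧)) (trans (cong₂ _+_ (∑-1 m) (∑0 m)) (+-identityʳ m))) ⟩
      count (is-hub ∘ splitAt m)
        ≤⟨ count-mono (hub⇒covered M maxM) ⟩
      count (covered M)
        ≡⟨ sym (Matching.2*size≡count-covered graph (proj₁ maxM)) ⟩
      2 * size M ∎)
    where
    open ≤-Reasoning
    hub⇒covered : ∀ M → IsMaximalMatching graph M → ∀ u → is-hub (splitAt m u) ≡ true → covered M u ≡ true
    hub⇒covered M maxM u hu with splitAt m u in e
    ... | inj₁ i = subst (λ t → covered M t ≡ true) (Fin.splitAt⁻¹-↑ˡ e) (hubs-covered maxM i)

pendant-clique-minimal : ∀ k d q r → d ≤ 1 → k + d ≡ q → (k + d) + k ≡ r → 0 < r → MinEdges 1 q r (suc r C 2)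
pendant-clique-minimal k d _ _ d≤1 refl refl 0<r =
  (graph , (connected a₀ , indMatchNum a₀ , minMatchNum d≤1 , matchNum) , numEdges≡[1+m]C2) ,
  λ G → realizes⇒[1+r]C2≤numEdges G _ _
  where
  open PendantClique k d
  a₀ = fromℕ< 0<r

caterpillar-minimal : ∀ s′ t q r → suc s′ + t ≡ q → suc s′ + q ≡ r → MinEdges q q r (2 * r ∸ 1)
caterpillar-minimal s′ t _ _ refl refl =
  (graph , realizes , numEdges≡2r∸1) , λ G → realizes⇒2r∸1≤numEdges G _ _ _ (s≤s z≤n)
  where open Caterpillar s′ t

minEdges[r,r,r] : ∀ r → 2 ≤ r → MinEdges r r r (2 * r)
minEdges[r,r,r] r 2≤r = (graph , realizes , numEdges≡2r) , λ G → realizes⇒2r≤numEdges G r 2≤r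
  where open Spider r

minEdges[1,q,2q] : ∀ q → 1 ≤ q → MinEdges 1 q (2 * q) ((2 * q + 1) C 2)
minEdges[1,q,2q] q 1≤q = subst (λ c → MinEdges 1 q (2 * q) (c C 2)) (+-comm 1 (2 * q))
  (pendant-clique-minimal q 0 q (2 * q) z≤n (+-identityʳ q) (double q)
                          (≤-trans (n≤1+n 1) (*-monoʳ-≤ 2 1≤q)))
  where
  double : ∀ q → (q + 0) + q ≡ 2 * q
  double = solve-∀

minEdges[1,q,2q∸1] : ∀ q → 1 ≤ q → MinEdges 1 q (2 * q ∸ 1) ((2 * q) C 2)
minEdges[1,q,2q∸1] (suc q′) _ =
  pendant-clique-minimal q′ 1 (suc q′) (2 * suc q′ ∸ 1) ≤-refl (+-comm q′ 1) (double-1 q′)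
                         (≤-trans (s≤s z≤n) (m≤n+m _ q′))
  where
  double-1 : ∀ q′ → (q′ + 1) + q′ ≡ q′ + suc (q′ + 0)
  double-1 = solve-∀

minEdges[q,q,r] : ∀ q r → q < r → r ≤ 2 * q → MinEdges q q r (2 * r ∸ 1)
minEdges[q,q,r] q r q<r r≤2q = caterpillar-minimal s′ t q r s+t≡q s+q≡r
  where
  s′ = r ∸ suc q
  t  = 2 * q ∸ r
  s+q≡r : suc s′ + q ≡ r
  s+q≡r = trans (+-comm (suc s′) q) (trans (+-suc q s′) (m+[n∸m]≡n q<r))
  s+t≡q : suc s′ + t ≡ q
  s+t≡q = +-cancelˡ-≡ q _ _ (begin
    q + (suc s′ + t)   ≡⟨ sym (+-assoc q (suc s′) t) ⟩
    (q + suc s′) + t   ≡⟨ cong (_+ t) (trans (+-comm q (suc s′)) s+q≡r) ⟩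
    r + t              ≡⟨ m+[n∸m]≡n r≤2q ⟩
    2 * q              ≡⟨ cong (q +_) (+-identityʳ q) ⟩
    q + q              ∎)
    where open ≡-Reasoning

theorem3p1 :
    ((q : ℕ) → 1 ≤ q →
       MinEdges 1 q (2 * q) ((2 * q + 1) C 2)
       × MinEdges 1 q (2 * q ∸ 1) ((2 * q) C 2))
    × ((q r : ℕ) → 2 ≤ q → q < r → r ≤ 2 * q →
       MinEdges q q r (2 * r ∸ 1))
    × ((r : ℕ) → 2 ≤ r →
       MinEdges r r r (2 * r))
theorem3p1 =
  (λ q 1≤q → minEdges[1,q,2q] q 1≤q , minEdges[1,q,2q∸1] q 1≤q) ,
  -- Part (2) does not need the hypothesis 2 ≤ q.
  (λ q r _ → minEdges[q,q,r] q r) ,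
  minEdges[r,r,r]
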